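{- Let $G=(V,E)$ be an instance of MFASP with Gallai–Edmonds decomposition $V=X\cup Y\cup Z$. Then: (i) for every optimal solution $(M^*,y^*,c^*)$: (a) $c^*_e=0$ for all $e\in E\setminus M^*$ and $0\le c^*_e\le 1$ for all $e\in M^*$; (b) $|M^*|=\nu(G)$, i.e. $M^*$ is a maximum-cardinality matching of $G$. (ii) there exists an optimal solution $(M^*,y^*,c^*)$ such that (c) $c^*$ is half-integral (i.e. $c^*\in\frac12\mathbb{Z}^E$), and (d) $y^*\in\{0,\frac12,1\}^V$ and $y^*_v>0$ for every $v\in Y$.
   Context: All graphs are finite, undirected and simple, with unit edge weights; $\nu(G)$ denotes the maximum cardinality of a matching. For $w\in\mathbb{R}^E_{\ge 0}$, a fractional $w$-vertex cover is $y\in\mathbb{R}^V_{\ge 0}$ with $y_u+y_v\ge w_{uv}$ for all $\{u,v\}\in E$. A feasible solution of MFASP is a triple $(M,y,c)$ where $c\in\mathbb{R}^E_{\ge 0}$, $M$ is a matching, $y$ is a fractional $(\mathbb{1}+c)$-vertex cover, and $\sum_{e\in M}(1+c_e)=\sum_{v\in V}y_v$ (equivalently, $(G,\mathbb{1}+c)$ is stable, $M$ is a maximum $(\mathbb{1}+c)$-weight matching and $y$ a minimum fractional $(\mathbb{1}+c)$-vertex cover). It is optimal if $\sum_{e\in E}c_e$ is minimum among all feasible solutions. Gallai–Edmonds decomposition: $X$ is the set of vertices exposed by at least one maximum-cardinality matching, $Y$ the set of vertices not in $X$ adjacent to a vertex of $X$ (the Tutte set), $Z=V\setminus(X\cup 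Y)$.
   Formalization: The vectors c and y of MFASP solutions, both the optimal ones and the feasible solutions they are compared against, take rational values rather than real ones. -}

module Defs where

open import Data.Nat as ℕ using (ℕ; zero; suc)
open import Data.Fin using (Fin; zero; suc; toℕ)
open import Data.Bool using (Bool; true; false; if_then_else_)
open import Data.Integer using (ℤ)
open import Data.Rational using (ℚ; 0ℚ; 1ℚ; ½; _+_; _≤_; _/_)
open import Data.Product using (Σ; ∃; _×_; _,_; proj₁; proj₂)
open import Data.Sum using (_⊎_)
open import Relation.Nullary using (¬_)
open import Relation.Binary.PropositionalEquality using (_≡_; _≢_)

-- Each edge e has endpoints (u , v) with u < v (no loops, canonical
-- orientation), and distinct edges have distinct endpoint pairs
-- (no parallel edges).
record Graph : Set where
  field
    n     : ℕ
    m     : ℕ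
    ends  : Fin m → Fin n × Fin n
    loopless : ∀ e → toℕ (proj₁ (ends e)) ℕ.< toℕ (proj₂ (ends e))
    simple   : ∀ e e′ → ends e ≡ ends e′ → e ≡ e′

open Graph public

Σℚ : (k : ℕ) → (Fin k → ℚ) → ℚ
Σℚ zero    f = 0ℚ
Σℚ (suc k) f = f zero + Σℚ k (λ i → f (suc i))

count : (k : ℕ) → (Fin k → Bool) → ℕ
count zero    f = zero
count (suc k) f = (if f zero then 1 else 0) ℕ.+ count k (λ i → f (suc i))

module _ (G : Graph) where

  Vtx : Set
  Vtx = Fin (n G)

  Edge : Set
  Edge = Fin (m G)

  Inc : Vtx → Edge → Set
  Inc v e = proj₁ (ends G e) ≡ v ⊎ proj₂ (ends G e) ≡ v

  Adj : Vtx → Vtx → Set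
  Adj u v = ∃ λ (e : Edge) → ends G e ≡ (u , v) ⊎ ends G e ≡ (v , u)

  EdgeSet : Set
  EdgeSet = Edge → Bool

  IsMatching : EdgeSet → Set
  IsMatching M = ∀ e e′ → M e ≡ true → M e′ ≡ true → e ≢ e′ →
                 ∀ v → Inc v e → ¬ Inc v e′

  size : EdgeSet → ℕ
  size M = count (m G) M

  IsMaxCardMatching : EdgeSet → Set
  IsMaxCardMatching M = IsMatching M × (∀ M′ → IsMatching M′ → size M′ ℕ.≤ size M)

  Exposed : Vtx → EdgeSet → Set
  Exposed v M = ∀ e → M e ≡ true → ¬ Inc v e

  InX : Vtx → Set
  InX v = ∃ λ M → IsMaxCardMatching M × Exposed v M

  InY : Vtx → Set
  InY v = ¬ InX v × (∃ λ u → InX u × Adj v u)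

  matchWeight : EdgeSet → (Edge → ℚ) → ℚ
  matchWeight M c = Σℚ (m G) (λ e → if M e then 1ℚ + c e else 0ℚ)

  IsFracCover : (Edge → ℚ) → (Vtx → ℚ) → Set
  IsFracCover c y = (∀ v → 0ℚ ≤ y v) ×
                    (∀ e → 1ℚ + c e ≤ y (proj₁ (ends G e)) + y (proj₂ (ends G e)))

  Feasible : EdgeSet → (Vtx → ℚ) → (Edge → ℚ) → Set
  Feasible M y c = (∀ e → 0ℚ ≤ c e) × IsMatching M × IsFracCover c y ×
                   matchWeight M c ≡ Σℚ (n G) y

  Optimal : EdgeSet → (Vtx → ℚ) → (Edge → ℚ) → Set
  Optimal M y c = Feasible M y c ×
    (∀ M′ y′ c′ → Feasible M′ y′ c′ → Σℚ (m G) c ≤ Σℚ (m G) c′)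

  HalfIntegral : (Edge → ℚ) → Set
  HalfIntegral c = ∀ e → Σ ℤ λ k → c e ≡ k / 2

-- An MFASP solution (M , y , c) has Σ_{e∈M} (1 + c e) = Σ_v y v ≥ Σ_{uw∈M} (y u + y w), so c e = y u + y w - 1
-- on M, y vanishes on M-exposed vertices and Σ c ≥ Σ y - |M|. Optimal solutions are thus the pairs (M , y)
-- minimising the excess Σ y - |M|, with c zero off M. At such a pair y ≤ 1, since capping y at 1 lowers the
-- excess, hence c ≤ 1 on M; and M is maximum, since an augmenting path yields a larger matching covering
-- every vertex that M covers.
-- The values of y in (0,½) and those in (½,1) can be shifted in opposite directions by a common ε without
-- uncovering an edge; taking the direction that does not increase Σ y and ε as large as possible makes one
-- more value lie in {0,½,1}. Hence a minimiser exists among the finitely many {0,½,1}-valued pairs.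
-- Finally, a zero of y at a vertex v outside X is removed, without changing Σ y, by an alternating search
-- from v in the style of Edmonds' algorithm.

module Submission where

open import Defs
open import Algebra.Bundles using (CommutativeRing)
open import Data.Bool using (Bool; true; false; _∧_; _∨_; _xor_; if_then_else_)
open import Data.Bool.Properties using (xor-same; ¬-not; not-¬) renaming (_≟_ to _≟ᵇ_)
open import Data.Empty using (⊥; ⊥-elim)
open import Data.Fin using (Fin; zero; suc; toℕ)
open import Data.Fin.Properties using (any?; all?) renaming (_≟_ to _≟ᶠ_)
open import Data.Integer using (ℤ; 0ℤ; 1ℤ; -1ℤ; +[1+_]; -[1+_])
open import Data.List using (List; []; _∷_; filter; allFin; cartesianProductWith; cartesianProduct)
open import Data.List.Membership.Propositional using (_∈_)
open import Data.List.Membership.Propositional.Properties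
  using (∈-cartesianProductWith⁺; ∈-cartesianProduct⁺; ∈-filter⁺; ∈-allFin)
open import Data.List.Relation.Unary.All using (lookup)
open import Data.List.Relation.Unary.All.Properties using (all-filter)
open import Data.List.Relation.Unary.Any using (here; there)
open import Data.Nat as ℕ using (ℕ; zero; suc; z≤n; s≤s; _∸_)
import Data.Nat.Properties as ℕ
open import Data.Nat.Induction using (<-wellFounded)
open import Data.Product using (Σ; ∃; _×_; _,_; proj₁; proj₂)
open import Data.Rational using (ℚ; 0ℚ; 1ℚ; ½; _+_; _*_; -_; _-_; _/_; _≤_; _<_; _⊓_; nonNegative)
open import Data.Rational.Properties
open import Data.Rational.Solver using (module +-*-Solver)
open import Data.Sum using (_⊎_; inj₁; inj₂; map₁)
open import Data.Vec.Functional using (updateAt) renaming (_∷_ to _∷ᶠ_)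
open import Data.Vec.Functional.Properties using (updateAt-updates; updateAt-minimal)
open import Function using (_∘_; id)
open import Induction.WellFounded using (Acc; acc)
open import Relation.Binary.Bundles using (DecTotalOrder)
open import Relation.Binary.Definitions using (tri<; tri≈; tri>)
open import Relation.Binary.PropositionalEquality
open import Relation.Nullary using (Dec; yes; no; does; ¬_)
open import Relation.Nullary.Decidable
  using (¬?; _×-dec_; _⊎-dec_; _→-dec_; map′; from-yes; decidable-stable; dec-true; dec-false)

open import Algebra.Properties.Semiring.Sum (CommutativeRing.semiring +-*-commutativeRing)
  using (sum; sum-cong-≗; ∑-distrib-+; ∑-comm; *-distribˡ-sum; sum-replicate-zero)
open import Data.List.Extrema ℕ.≤-totalOrder using (argmax; f[xs]≤f[argmax]; argmax-all)
open import Data.List.Extrema (DecTotalOrder.totalOrder ≤-decTotalOrder)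
  using (argmin; f[argmin]≤f[xs]; argmin-all)

open +-*-Solver

0<1 : 0ℚ < 1ℚ
0<1 = from-yes (0ℚ <? 1ℚ)

0<½ : 0ℚ < ½
0<½ = from-yes (0ℚ <? ½)

½<1 : ½ < 1ℚ
½<1 = from-yes (½ <? 1ℚ)

p≤p+q : ∀ {p q} → 0ℚ ≤ q → p ≤ p + q
p≤p+q {p} 0≤q = subst (_≤ p + _) (+-identityʳ p) (+-monoʳ-≤ p 0≤q)

p-q≤p : ∀ {p q} → 0ℚ ≤ q → p - q ≤ p
p-q≤p {p} 0≤q = subst (p - _ ≤_) (+-identityʳ p) (+-monoʳ-≤ p (neg-antimono-≤ 0≤q))

p≤q⇒0≤q-p : ∀ {p q} → p ≤ q → 0ℚ ≤ q - p
p≤q⇒0≤q-p {p} {q} p≤q = subst (_≤ q - p) (+-inverseʳ p) (+-monoˡ-≤ (- p) p≤q)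

q≤r-p⇒p+q≤r : ∀ {p q r} → q ≤ r - p → p + q ≤ r
q≤r-p⇒p+q≤r {p} {q} {r} q≤r-p = subst (p + q ≤_) (solve 2 (λ p r → p :+ (r :- p) := r) refl p r) (+-monoʳ-≤ p q≤r-p)

q≤p-r⇒r≤p-q : ∀ {p q r} → q ≤ p - r → r ≤ p - q
q≤p-r⇒r≤p-q {p} {q} {r} q≤p-r = subst (_≤ p - q) (solve 2 (λ p r → p :- (p :- r) := r) refl p r)
    (+-monoʳ-≤ p (neg-antimono-≤ q≤p-r))

p+q*r≤p : ∀ {p q r} → 0ℚ ≤ q → r ≤ 0ℚ → p + q * r ≤ p
p+q*r≤p {p} {q} 0≤q r≤0 =
  subst (p + q * _ ≤_) (+-identityʳ p)
      (+-monoʳ-≤ p (subst (q * _ ≤_) (*-zeroʳ q) (*-monoˡ-≤-nonNeg q {{nonNegative 0≤q}} r≤0)))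

1≤1+p : ∀ {p} → 0ℚ ≤ p → 1ℚ ≤ 1ℚ + p
1≤1+p 0≤p = +-monoʳ-≤ 1ℚ 0≤p

≤∧≢⇒< : ∀ {p q} → p ≤ q → p ≢ q → p < q
≤∧≢⇒< {p} {q} p≤q p≢q with p <? q
... | yes p<q = p<q
... | no  p≮q = ⊥-elim (p≢q (≤-antisym p≤q (≮⇒≥ p≮q)))

+-cancelˡ-< : ∀ {p q r} → p + q < p + r → q < r
+-cancelˡ-< {p} {q} {r} p+q<p+r with q <? r
... | yes q<r = q<r
... | no  q≮r = ⊥-elim (<-irrefl refl (<-≤-trans p+q<p+r (+-monoʳ-≤ p (≮⇒≥ q≮r))))

ind : Bool → ℚ → ℚ
ind b q = if b then q else 0ℚ

ind-nonneg : ∀ b {q} → 0ℚ ≤ q → 0ℚ ≤ ind b q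
ind-nonneg true  0≤q = 0≤q
ind-nonneg false _   = ≤-refl

ind-≤ : ∀ b {q} → 0ℚ ≤ q → ind b q ≤ q
ind-≤ true  _   = ≤-refl
ind-≤ false 0≤q = 0≤q

ind-mono-≤ : ∀ b {p q} → p ≤ q → ind b p ≤ ind b q
ind-mono-≤ true  p≤q = p≤q
ind-mono-≤ false _   = ≤-refl

fromℕ : ℕ → ℚ
fromℕ zero    = 0ℚ
fromℕ (suc n) = 1ℚ + fromℕ n

fromℕ-nonneg : ∀ n → 0ℚ ≤ fromℕ n
fromℕ-nonneg zero    = ≤-refl
fromℕ-nonneg (suc n) = +-mono-≤ (<⇒≤ 0<1) (fromℕ-nonneg n)

fromℕ-mono-< : ∀ {m n} → m ℕ.< n → fromℕ m < fromℕ n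
fromℕ-mono-< {zero}  {suc n} _ = <-≤-trans 0<1 (+-monoʳ-≤ 1ℚ (fromℕ-nonneg n))
fromℕ-mono-< {suc m} (s≤s m<n) = +-monoʳ-< 1ℚ (fromℕ-mono-< m<n)

Σℚ-sum : ∀ k (f : Fin k → ℚ) → Σℚ k f ≡ sum f
Σℚ-sum zero    f = refl
Σℚ-sum (suc k) f = cong (f zero +_) (Σℚ-sum k (f ∘ suc))

module _ {k : ℕ} where

  Σℚ-cong : ∀ {f g : Fin k → ℚ} → (∀ i → f i ≡ g i) → Σℚ k f ≡ Σℚ k g
  Σℚ-cong {f} {g} f≗g = trans (Σℚ-sum k f) (trans (sum-cong-≗ f≗g) (sym (Σℚ-sum k g)))

  Σℚ-zero : ∀ {f : Fin k → ℚ} → (∀ i → f i ≡ 0ℚ) → Σℚ k f ≡ 0ℚ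
  Σℚ-zero f≗0 = trans (Σℚ-cong f≗0) (trans (Σℚ-sum k _) (sum-replicate-zero k))

  Σℚ-+ : ∀ (f g : Fin k → ℚ) → Σℚ k (λ i → f i + g i) ≡ Σℚ k f + Σℚ k g
  Σℚ-+ f g = trans (Σℚ-sum k _) (trans (∑-distrib-+ f g) (sym (cong₂ _+_ (Σℚ-sum k f) (Σℚ-sum k g))))

  Σℚ-*ˡ : ∀ c (f : Fin k → ℚ) → Σℚ k (λ i → c * f i) ≡ c * Σℚ k f
  Σℚ-*ˡ c f = trans (Σℚ-sum k _) (trans (sym (*-distribˡ-sum c f)) (cong (c *_) (sym (Σℚ-sum k f))))

  Σℚ-neg : ∀ (f : Fin k → ℚ) → Σℚ k (λ i → - f i) ≡ - Σℚ k f
  Σℚ-neg f = trans (Σℚ-cong (λ i → sym (neg-is-*-1 (f i)))) (trans (Σℚ-*ˡ (- 1ℚ) f) (neg-is-*-1 (Σℚ k f)))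
    where
    neg-is-*-1 : ∀ p → - 1ℚ * p ≡ - p
    neg-is-*-1 p = trans (sym (neg-distribˡ-* 1ℚ p)) (cong -_ (*-identityˡ p))

  Σℚ-- : ∀ (f g : Fin k → ℚ) → Σℚ k (λ i → f i - g i) ≡ Σℚ k f - Σℚ k g
  Σℚ-- f g = trans (Σℚ-+ f (λ i → - g i)) (cong (Σℚ k f +_) (Σℚ-neg g))

Σℚ-comm : ∀ a b (h : Fin a → Fin b → ℚ) →
          Σℚ a (λ i → Σℚ b (h i)) ≡ Σℚ b (λ j → Σℚ a (λ i → h i j))
Σℚ-comm a b h = begin
  Σℚ a (λ i → Σℚ b (h i))            ≡⟨ Σℚ-cong (λ i → Σℚ-sum b (h i)) ⟩
  Σℚ a (λ i → sum (h i))             ≡⟨ Σℚ-sum a _ ⟩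
  sum (λ i → sum (h i))              ≡⟨ ∑-comm h ⟩
  sum (λ j → sum (λ i → h i j))      ≡⟨ sym (Σℚ-sum b _) ⟩
  Σℚ b (λ j → sum (λ i → h i j))     ≡⟨ Σℚ-cong (λ j → sym (Σℚ-sum a (λ i → h i j))) ⟩
  Σℚ b (λ j → Σℚ a (λ i → h i j))    ∎
  where open ≡-Reasoning

Σℚ-mono-≤ : ∀ {k} {f g : Fin k → ℚ} → (∀ i → f i ≤ g i) → Σℚ k f ≤ Σℚ k g
Σℚ-mono-≤ {zero}  _   = ≤-refl
Σℚ-mono-≤ {suc k} f≤g = +-mono-≤ (f≤g zero) (Σℚ-mono-≤ (f≤g ∘ suc))

Σℚ-mono-< : ∀ {k} {f g : Fin k → ℚ} → (∀ i → f i ≤ g i) → ∀ j → f j < g j → Σℚ k f < Σℚ k g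
Σℚ-mono-< {suc k} f≤g zero    fj<gj = +-mono-<-≤ fj<gj (Σℚ-mono-≤ (f≤g ∘ suc))
Σℚ-mono-< {suc k} f≤g (suc j) fj<gj = +-mono-≤-< (f≤g zero) (Σℚ-mono-< (f≤g ∘ suc) j fj<gj)

Σℚ-≤-tight : ∀ {k} {f g : Fin k → ℚ} → (∀ i → f i ≤ g i) → Σℚ k g ≤ Σℚ k f → ∀ i → f i ≡ g i
Σℚ-≤-tight {f = f} {g} f≤g Σg≤Σf i with f i ≟ g i
... | yes fi≡gi = fi≡gi
... | no  fi≢gi = ⊥-elim (<-irrefl refl (<-≤-trans (Σℚ-mono-< f≤g i (≤∧≢⇒< (f≤g i) fi≢gi)) Σg≤Σf))

Σℚ-<⇒∃ : ∀ {k} {f g : Fin k → ℚ} → Σℚ k f < Σℚ k g → ∃ λ i → f i < g i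
Σℚ-<⇒∃ {zero} Σf<Σg = ⊥-elim (<-irrefl refl Σf<Σg)
Σℚ-<⇒∃ {suc k} {f} {g} Σf<Σg with f zero <? g zero
... | yes f0<g0 = zero , f0<g0
... | no  f0≮g0 =
  let i , fi<gi = Σℚ-<⇒∃ {k} {f ∘ suc} {g ∘ suc}
                    (+-cancelˡ-< {g zero} (≤-<-trans (+-monoˡ-≤ (Σℚ k (f ∘ suc)) (≮⇒≥ f0≮g0)) Σf<Σg))
  in suc i , fi<gi

Σℚ-pick : ∀ {k} (j : Fin k) (f : Fin k → ℚ) → Σℚ k (λ i → ind (does (j ≟ᶠ i)) (f i)) ≡ f j
Σℚ-pick {suc k} zero    f = trans (cong (f zero +_) (Σℚ-zero {k} (λ _ → refl))) (+-identityʳ (f zero))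
Σℚ-pick {suc k} (suc j) f = trans (+-identityˡ _) (Σℚ-pick j (f ∘ suc))

Σℚ-count : ∀ k (b : Fin k → Bool) → Σℚ k (λ i → ind (b i) 1ℚ) ≡ fromℕ (count k b)
Σℚ-count zero    b = refl
Σℚ-count (suc k) b with b zero
... | true  = cong (1ℚ +_) (Σℚ-count k (b ∘ suc))
... | false = trans (+-identityˡ _) (Σℚ-count k (b ∘ suc))

insert : ∀ {k} → Fin k → (Fin k → Bool) → Fin k → Bool
insert i b = updateAt b i (λ _ → true)

delete : ∀ {k} → Fin k → (Fin k → Bool) → Fin k → Bool
delete i b = updateAt b i (λ _ → false)

count-cong : ∀ k {f g : Fin k → Bool} → (∀ i → f i ≡ g i) → count k f ≡ count k g
count-cong zero    f≗g = refl
count-cong (suc k) f≗g = cong₂ (λ b n → (if b then 1 else 0) ℕ.+ n) (f≗g zero) (count-cong k (f≗g ∘ suc))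

count-≤ : ∀ k (f : Fin k → Bool) → count k f ℕ.≤ k
count-≤ zero    f = z≤n
count-≤ (suc k) f with f zero
... | true  = s≤s (count-≤ k (f ∘ suc))
... | false = ℕ.m≤n⇒m≤1+n (count-≤ k (f ∘ suc))

count-mono : ∀ k {f g : Fin k → Bool} → (∀ i → f i ≡ true → g i ≡ true) → count k f ℕ.≤ count k g
count-mono zero    f⊆g = z≤n
count-mono (suc k) {f} {g} f⊆g with f zero in f0 | g zero in g0
... | true  | true  = s≤s (count-mono k (f⊆g ∘ suc))
... | true  | false = ⊥-elim (not-¬ (f⊆g zero f0) g0)
... | false | true  = ℕ.m≤n⇒m≤1+n (count-mono k (f⊆g ∘ suc))
... | false | false = count-mono k (f⊆g ∘ suc)

count-mono-< : ∀ k {f g : Fin k → Bool} → (∀ i → f i ≡ true → g i ≡ true) →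
               ∀ j → f j ≡ false → g j ≡ true → count k f ℕ.< count k g
count-mono-< (suc k) {f} {g} f⊆g zero fj gj rewrite fj | gj = s≤s (count-mono k (f⊆g ∘ suc))
count-mono-< (suc k) {f} {g} f⊆g (suc j) fj gj with f zero in f0 | g zero in g0
... | true  | true  = s≤s (count-mono-< k (f⊆g ∘ suc) j fj gj)
... | true  | false = ⊥-elim (not-¬ (f⊆g zero f0) g0)
... | false | true  = ℕ.m≤n⇒m≤1+n (count-mono-< k (f⊆g ∘ suc) j fj gj)
... | false | false = count-mono-< k (f⊆g ∘ suc) j fj gj

count-insert : ∀ k (f : Fin k → Bool) i → f i ≡ false → count k (insert i f) ≡ suc (count k f)
count-insert (suc k) f zero    fi rewrite fi = refl
count-insert (suc k) f (suc i) fi with f zero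
... | true  = cong suc (count-insert k (f ∘ suc) i fi)
... | false = count-insert k (f ∘ suc) i fi

count-delete : ∀ k (f : Fin k → Bool) i → f i ≡ true → suc (count k (delete i f)) ≡ count k f
count-delete (suc k) f zero    fi rewrite fi = refl
count-delete (suc k) f (suc i) fi with f zero
... | true  = cong suc (count-delete k (f ∘ suc) i fi)
... | false = count-delete k (f ∘ suc) i fi

insert-≡ : ∀ {k} i (f : Fin k → Bool) → insert i f i ≡ true
insert-≡ i f = updateAt-updates i f

insert-≢ : ∀ {k} {i j} (f : Fin k → Bool) → j ≢ i → insert i f j ≡ f j
insert-≢ {i = i} {j} f j≢i = updateAt-minimal j i f j≢i

insert⁺ : ∀ {k} i (f : Fin k → Bool) {j} → f j ≡ true → insert i f j ≡ true
insert⁺ i f {j} fj with j ≟ᶠ i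
... | yes refl = insert-≡ i f
... | no  j≢i  = trans (insert-≢ f j≢i) fj

insert⁻ : ∀ {k} i (f : Fin k → Bool) {j} → insert i f j ≡ true → j ≡ i ⊎ f j ≡ true
insert⁻ i f {j} ins with j ≟ᶠ i
... | yes j≡i = inj₁ j≡i
... | no  j≢i = inj₂ (trans (sym (insert-≢ f j≢i)) ins)

delete-≡ : ∀ {k} i (f : Fin k → Bool) → delete i f i ≡ false
delete-≡ i f = updateAt-updates i f

delete-≢ : ∀ {k} {i j} (f : Fin k → Bool) → j ≢ i → delete i f j ≡ f j
delete-≢ {i = i} {j} f j≢i = updateAt-minimal j i f j≢i

delete⁻ : ∀ {k} i (f : Fin k → Bool) {j} → delete i f j ≡ true → j ≢ i × f j ≡ true
delete⁻ i f {j} del with j ≟ᶠ i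
... | yes refl = ⊥-elim (not-¬ del (delete-≡ i f))
... | no  j≢i  = j≢i , trans (sym (delete-≢ f j≢i)) del

ZeroHalfOne : ℚ → Set
ZeroHalfOne p = p ≡ 0ℚ ⊎ p ≡ ½ ⊎ p ≡ 1ℚ

zeroHalfOne? : ∀ p → Dec (ZeroHalfOne p)
zeroHalfOne? p = (p ≟ 0ℚ) ⊎-dec (p ≟ ½) ⊎-dec (p ≟ 1ℚ)

data Position (p : ℚ) : Set where
  settled : ZeroHalfOne p → Position p
  lower   : 0ℚ < p → p < ½ → Position p
  upper   : ½ < p → p < 1ℚ → Position p

position : ∀ {p} → 0ℚ ≤ p → p ≤ 1ℚ → Position p
position {p} 0≤p p≤1 with <-cmp p ½
... | tri≈ _ p≡½ _ = settled (inj₂ (inj₁ p≡½))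
... | tri< p<½ _ _ with 0ℚ <? p
...   | yes 0<p = lower 0<p p<½
...   | no  0≮p = settled (inj₁ (≤-antisym (≮⇒≥ 0≮p) 0≤p))
position {p} 0≤p p≤1 | tri> _ _ ½<p with p <? 1ℚ
...   | yes p<1 = upper ½<p p<1
...   | no  p≮1 = settled (inj₂ (inj₂ (≤-antisym p≤1 (≮⇒≥ p≮1))))

data Direction : Set where
  outward inward : Direction

slope : Direction → ∀ {p} → Position p → ℚ
slope _       (settled _) = 0ℚ
slope outward (lower _ _) = - 1ℚ
slope outward (upper _ _) = 1ℚ
slope inward  (lower _ _) = 1ℚ
slope inward  (upper _ _) = - 1ℚ

slope-inward : ∀ {p} (P : Position p) → slope inward P ≡ - slope outward P
slope-inward (settled _) = refl
slope-inward (lower _ _) = refl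
slope-inward (upper _ _) = refl

room : Direction → ∀ {p} → Position p → ℚ
room _       (settled _) = 0ℚ
room outward {p} (lower _ _) = p
room outward {p} (upper _ _) = 1ℚ - p
room inward  {p} (lower _ _) = ½ - p
room inward  {p} (upper _ _) = p - ½

move : Direction → ∀ {p} → Position p → ℚ → ℚ
move _       {p} (settled _) ε = p
move outward {p} (lower _ _) ε = p - ε
move outward {p} (upper _ _) ε = p + ε
move inward  {p} (lower _ _) ε = p + ε
move inward  {p} (upper _ _) ε = p - ε

move-slope : ∀ d {p} (P : Position p) ε → move d P ε ≡ p + ε * slope d P
move-slope _       {p} (settled _) ε = sym (trans (cong (p +_) (*-zeroʳ ε)) (+-identityʳ p))
move-slope outward {p} (lower _ _) ε = solve 2 (λ p ε → p :- ε := p :+ ε :* con (- 1ℚ)) refl p ε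
move-slope outward {p} (upper _ _) ε = solve 2 (λ p ε → p :+ ε := p :+ ε :* con 1ℚ) refl p ε
move-slope inward  {p} (lower _ _) ε = solve 2 (λ p ε → p :+ ε := p :+ ε :* con 1ℚ) refl p ε
move-slope inward  {p} (upper _ _) ε = solve 2 (λ p ε → p :- ε := p :+ ε :* con (- 1ℚ)) refl p ε

data Stays {p} : Position p → ℚ → Set where
  settled : ∀ {h p′} → p′ ≡ p → Stays (settled h) p′
  lower   : ∀ {0<p p<½ p′} → 0ℚ ≤ p′ → p′ ≤ ½ → Stays (lower 0<p p<½) p′
  upper   : ∀ {½<p p<1 p′} → ½ ≤ p′ → p′ ≤ 1ℚ → Stays (upper ½<p p<1) p′

stays : ∀ d {p} (P : Position p) {ε} → 0ℚ ≤ ε → ε ≤ room d P → Stays P (move d P ε)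
stays _           (settled _)     _   _      = settled refl
stays outward {p} (lower 0<p p<½) 0≤ε ε≤room = lower (p≤q⇒0≤q-p ε≤room) (≤-trans (p-q≤p {p} 0≤ε) (<⇒≤ p<½))
stays outward {p} (upper ½<p p<1) 0≤ε ε≤room = upper (≤-trans (<⇒≤ ½<p) (p≤p+q {p} 0≤ε)) (q≤r-p⇒p+q≤r {p} ε≤room)
stays inward  {p} (lower 0<p p<½) 0≤ε ε≤room = lower (≤-trans (<⇒≤ 0<p) (p≤p+q {p} 0≤ε)) (q≤r-p⇒p+q≤r {p} ε≤room)
stays inward  {p} (upper ½<p p<1) 0≤ε ε≤room = upper (q≤p-r⇒r≤p-q {p} ε≤room) (≤-trans (p-q≤p {p} 0≤ε) (<⇒≤ p<1))

settled-covers : ∀ {p q q′} → ZeroHalfOne p → (Q : Position q) → Stays Q q′ → 1ℚ ≤ p + q → 1ℚ ≤ p + q′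
settled-covers {p} _ (settled _) (settled q′≡q) 1≤p+q = subst (λ r → 1ℚ ≤ p + r) (sym q′≡q) 1≤p+q
settled-covers (inj₁ refl) (lower _ q<½) _ 1≤0+q =
  ⊥-elim (<-irrefl refl (≤-<-trans 1≤0+q (subst (_< 1ℚ) (sym (+-identityˡ _)) (<-trans q<½ ½<1))))
settled-covers (inj₁ refl) (upper _ q<1) _ 1≤0+q =
  ⊥-elim (<-irrefl refl (≤-<-trans 1≤0+q (subst (_< 1ℚ) (sym (+-identityˡ _)) q<1)))
settled-covers (inj₂ (inj₁ refl)) (lower _ q<½) _ 1≤½+q = ⊥-elim (<-irrefl refl (≤-<-trans 1≤½+q (+-monoʳ-< ½ q<½)))
settled-covers (inj₂ (inj₁ refl)) (upper _ _) (upper ½≤q′ _) _ = +-monoʳ-≤ ½ ½≤q′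
settled-covers (inj₂ (inj₂ refl)) (lower _ _) (lower 0≤q′ _) _ = 1≤1+p 0≤q′
settled-covers (inj₂ (inj₂ refl)) (upper _ _) (upper ½≤q′ _) _ = 1≤1+p (≤-trans (<⇒≤ 0<½) ½≤q′)

-- On an edge with a lower and an upper end the two moves cancel; any other covered edge has both ends at
-- least ½ after the move, an end fixed at 1, or no moving end.
covers-after : ∀ d {p q} (P : Position p) (Q : Position q) {ε} →
               Stays P (move d P ε) → Stays Q (move d Q ε) → 1ℚ ≤ p + q → 1ℚ ≤ move d P ε + move d Q ε
covers-after d (settled hp) Q (settled refl) sq 1≤p+q = settled-covers hp Q sq 1≤p+q
covers-after d {p} {q} P (settled hq) sp (settled refl) 1≤p+q =
  subst (1ℚ ≤_) (+-comm q _) (settled-covers hq P sp (subst (1ℚ ≤_) (+-comm p q) 1≤p+q))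
covers-after d (lower _ p<½) (lower _ q<½) _ _ 1≤p+q = ⊥-elim (<-irrefl refl (≤-<-trans 1≤p+q (+-mono-< p<½ q<½)))
covers-after d (upper _ _) (upper _ _) (upper ½≤p′ _) (upper ½≤q′ _) _ = +-mono-≤ ½≤p′ ½≤q′
covers-after outward {p} {q} (lower _ _) (upper _ _) {ε} _ _ 1≤p+q =
  subst (1ℚ ≤_) (solve 3 (λ p q ε → p :+ q := p :- ε :+ (q :+ ε)) refl p q ε) 1≤p+q
covers-after inward  {p} {q} (lower _ _) (upper _ _) {ε} _ _ 1≤p+q =
  subst (1ℚ ≤_) (solve 3 (λ p q ε → p :+ q := p :+ ε :+ (q :- ε)) refl p q ε) 1≤p+q
covers-after outward {p} {q} (upper _ _) (lower _ _) {ε} _ _ 1≤p+q =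
  subst (1ℚ ≤_) (solve 3 (λ p q ε → p :+ q := p :+ ε :+ (q :- ε)) refl p q ε) 1≤p+q
covers-after inward  {p} {q} (upper _ _) (lower _ _) {ε} _ _ 1≤p+q =
  subst (1ℚ ≤_) (solve 3 (λ p q ε → p :+ q := p :- ε :+ (q :+ ε)) refl p q ε) 1≤p+q

not-lower : ∀ {p} → ZeroHalfOne p → 0ℚ < p → p < ½ → ⊥
not-lower (inj₁ refl)        0<p _   = <-irrefl refl 0<p
not-lower (inj₂ (inj₁ refl)) _   p<½ = <-irrefl refl p<½
not-lower (inj₂ (inj₂ refl)) _   p<½ = <-asym p<½ ½<1

not-upper : ∀ {p} → ZeroHalfOne p → ½ < p → p < 1ℚ → ⊥
not-upper (inj₁ refl)        ½<p _   = <-asym ½<p 0<½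
not-upper (inj₂ (inj₁ refl)) ½<p _   = <-irrefl refl ½<p
not-upper (inj₂ (inj₂ refl)) _   p<1 = <-irrefl refl p<1

move-settled : ∀ d {p} (P : Position p) {ε} → ZeroHalfOne p → move d P ε ≡ p
move-settled d (settled _) _ = refl
move-settled d (lower 0<p p<½) z = ⊥-elim (not-lower z 0<p p<½)
move-settled d (upper ½<p p<1) z = ⊥-elim (not-upper z ½<p p<1)

stays-settled : ∀ d {p} (P : Position p) {ε} → ZeroHalfOne p → Stays P (move d P ε)
stays-settled d (settled _) _ = settled refl
stays-settled d (lower 0<p p<½) z = ⊥-elim (not-lower z 0<p p<½)
stays-settled d (upper ½<p p<1) z = ⊥-elim (not-upper z ½<p p<1)

stays-nonneg : ∀ {p p′} {P : Position p} → Stays P p′ → 0ℚ ≤ p → 0ℚ ≤ p′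
stays-nonneg (settled refl) 0≤p = 0≤p
stays-nonneg (lower 0≤p′ _) _   = 0≤p′
stays-nonneg (upper ½≤p′ _) _   = ≤-trans (<⇒≤ 0<½) ½≤p′

stays-≤1 : ∀ {p p′} {P : Position p} → Stays P p′ → p ≤ 1ℚ → p′ ≤ 1ℚ
stays-≤1 (settled refl) p≤1 = p≤1
stays-≤1 (lower _ p′≤½) _   = ≤-trans p′≤½ (<⇒≤ ½<1)
stays-≤1 (upper _ p′≤1) _   = p′≤1

room-nonneg : ∀ d {p} (P : Position p) → 0ℚ ≤ room d P
room-nonneg _       (settled _)     = ≤-refl
room-nonneg outward (lower 0<p _)   = <⇒≤ 0<p
room-nonneg outward (upper _ p<1)   = p≤q⇒0≤q-p (<⇒≤ p<1)
room-nonneg inward  (lower _ p<½)   = p≤q⇒0≤q-p (<⇒≤ p<½)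
room-nonneg inward  (upper ½<p _)   = p≤q⇒0≤q-p (<⇒≤ ½<p)

move-room : ∀ d {p} (P : Position p) → ZeroHalfOne (move d P (room d P))
move-room _       (settled z) = z
move-room outward {p} (lower _ _) = inj₁ (+-inverseʳ p)
move-room outward {p} (upper _ _) = inj₂ (inj₂ (solve 1 (λ p → p :+ (con 1ℚ :- p) := con 1ℚ) refl p))
move-room inward  {p} (lower _ _) = inj₂ (inj₁ (solve 1 (λ p → p :+ (con ½ :- p) := con ½) refl p))
move-room inward  {p} (upper _ _) = inj₂ (inj₁ (solve 1 (λ p → p :- (p :- con ½) := con ½) refl p))

ZeroHalfOne-≥1 : ∀ {p} → ZeroHalfOne p → 1ℚ ≤ p → p ≡ 1ℚ
ZeroHalfOne-≥1 (inj₁ refl)        1≤0 = ⊥-elim (<-irrefl refl (<-≤-trans 0<1 1≤0))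
ZeroHalfOne-≥1 (inj₂ (inj₁ refl)) 1≤½ = ⊥-elim (<-irrefl refl (<-≤-trans ½<1 1≤½))
ZeroHalfOne-≥1 (inj₂ (inj₂ p≡1))  _   = p≡1

ZeroHalfOne-≢0 : ∀ {p} → ZeroHalfOne p → p ≢ 0ℚ → ½ ≤ p
ZeroHalfOne-≢0 (inj₁ p≡0)        p≢0 = ⊥-elim (p≢0 p≡0)
ZeroHalfOne-≢0 (inj₂ (inj₁ refl)) _  = ≤-refl
ZeroHalfOne-≢0 (inj₂ (inj₂ refl)) _  = <⇒≤ ½<1

ind-half-integral : ∀ b {p q} → ZeroHalfOne p → ZeroHalfOne q → Σ ℤ λ k → ind b (p + q - 1ℚ) ≡ k / 2
ind-half-integral false _ _ = 0ℤ , refl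
ind-half-integral true (inj₁ refl)        (inj₁ refl)        = -[1+ 1 ] , refl
ind-half-integral true (inj₁ refl)        (inj₂ (inj₁ refl)) = -1ℤ , refl
ind-half-integral true (inj₁ refl)        (inj₂ (inj₂ refl)) = 0ℤ , refl
ind-half-integral true (inj₂ (inj₁ refl)) (inj₁ refl)        = -1ℤ , refl
ind-half-integral true (inj₂ (inj₁ refl)) (inj₂ (inj₁ refl)) = 0ℤ , refl
ind-half-integral true (inj₂ (inj₁ refl)) (inj₂ (inj₂ refl)) = 1ℤ , refl
ind-half-integral true (inj₂ (inj₂ refl)) (inj₁ refl)        = 0ℤ , refl
ind-half-integral true (inj₂ (inj₂ refl)) (inj₂ (inj₁ refl)) = 1ℤ , refl
ind-half-integral true (inj₂ (inj₂ refl)) (inj₂ (inj₂ refl)) = +[1+ 1 ] , refl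

ZeroHalfOne-pos : ∀ {p} → ZeroHalfOne p → p ≢ 0ℚ → 0ℚ < p
ZeroHalfOne-pos z p≢0 = <-≤-trans 0<½ (ZeroHalfOne-≢0 z p≢0)

module _ (G : Graph) where

  end₁ end₂ : Edge G → Vtx G
  end₁ e = proj₁ (ends G e)
  end₂ e = proj₂ (ends G e)

  end₁≢end₂ : ∀ e → end₁ e ≢ end₂ e
  end₁≢end₂ e eq = ℕ.<-irrefl (cong toℕ eq) (loopless G e)

  inc₁ : ∀ e → Inc G (end₁ e) e
  inc₁ e = inj₁ refl

  inc₂ : ∀ e → Inc G (end₂ e) e
  inc₂ e = inj₂ refl

  inc? : ∀ v e → Dec (Inc G v e)
  inc? v e = (end₁ e ≟ᶠ v) ⊎-dec (end₂ e ≟ᶠ v)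

  opposite : ∀ {v e} → Inc G v e → Vtx G
  opposite {e = e} (inj₁ _) = end₂ e
  opposite {e = e} (inj₂ _) = end₁ e

  Inc-opposite : ∀ {v e} (i : Inc G v e) → Inc G (opposite i) e
  Inc-opposite (inj₁ _) = inc₂ _
  Inc-opposite (inj₂ _) = inc₁ _

  opposite≢ : ∀ {v e} (i : Inc G v e) → opposite i ≢ v
  opposite≢ {e = e} (inj₁ refl) eq = end₁≢end₂ e (sym eq)
  opposite≢ {e = e} (inj₂ refl) eq = end₁≢end₂ e eq

  Inc-ends : ∀ {v x e} (i : Inc G v e) → Inc G x e → x ≡ v ⊎ x ≡ opposite i
  Inc-ends (inj₁ refl) (inj₁ refl) = inj₁ refl
  Inc-ends (inj₁ refl) (inj₂ refl) = inj₂ refl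
  Inc-ends (inj₂ refl) (inj₁ refl) = inj₂ refl
  Inc-ends (inj₂ refl) (inj₂ refl) = inj₁ refl

  Covered : EdgeSet G → Vtx G → Set
  Covered M v = ∃ λ e → M e ≡ true × Inc G v e

  covered? : ∀ M v → Dec (Covered M v)
  covered? M v = any? (λ e → (M e ≟ᵇ true) ×-dec inc? v e)

  covers : EdgeSet G → Vtx G → Bool
  covers M v = does (covered? M v)

  Exposed⇒¬Covered : ∀ {M v} → Exposed G v M → ¬ Covered M v
  Exposed⇒¬Covered exp (e , Me , i) = exp e Me i

  ¬Covered⇒Exposed : ∀ {M v} → ¬ Covered M v → Exposed G v M
  ¬Covered⇒Exposed ¬cov e Me i = ¬cov (e , Me , i)

  exposed-≢ : ∀ {M u v e} → Exposed G u M → M e ≡ true → Inc G v e → v ≢ u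
  exposed-≢ exp Me v∈e refl = exp _ Me v∈e

  matched-unique : ∀ {M v e f} → IsMatching G M → M e ≡ true → M f ≡ true → Inc G v e → Inc G v f → e ≡ f
  matched-unique {e = e} {f} isM Me Mf ie if with e ≟ᶠ f
  ... | yes e≡f = e≡f
  ... | no  e≢f = ⊥-elim (isM e f Me Mf e≢f _ ie if)

  subset-matching : ∀ {M M′} → (∀ e → M′ e ≡ true → M e ≡ true) → IsMatching G M → IsMatching G M′
  subset-matching M′⊆M isM e f M′e M′f = isM e f (M′⊆M e M′e) (M′⊆M f M′f)

  delete-matching : ∀ {M} e → IsMatching G M → IsMatching G (delete e M)
  delete-matching {M} e = subset-matching (λ f del → proj₂ (delete⁻ e M del))

  ends-exposed : ∀ {M v e} → Exposed G (end₁ e) M → Exposed G (end₂ e) M → Inc G v e → Exposed G v M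
  ends-exposed exp₁ exp₂ (inj₁ refl) = exp₁
  ends-exposed exp₁ exp₂ (inj₂ refl) = exp₂

  insert-matching : ∀ {M} e → IsMatching G M → Exposed G (end₁ e) M → Exposed G (end₂ e) M →
                    IsMatching G (insert e M)
  insert-matching {M} e isM exp₁ exp₂ f f′ Mf Mf′ f≢f′ v if if′
    with insert⁻ e M Mf | insert⁻ e M Mf′
  ... | inj₁ refl | inj₁ refl = f≢f′ refl
  ... | inj₁ refl | inj₂ Mf′ = ends-exposed exp₁ exp₂ if f′ Mf′ if′
  ... | inj₂ Mf   | inj₁ refl = ends-exposed exp₁ exp₂ if′ f Mf if
  ... | inj₂ Mf   | inj₂ Mf′ = isM f f′ Mf Mf′ f≢f′ v if if′

  delete-exposed : ∀ {M v e} → Exposed G v M → Exposed G v (delete e M)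
  delete-exposed {M} {e = e} exp f del = exp f (proj₂ (delete⁻ e M del))

  delete-exposes : ∀ {M v e} → IsMatching G M → M e ≡ true → Inc G v e → Exposed G v (delete e M)
  delete-exposes {M} {e = e} isM Me ie f del if =
    let f≢e , Mf = delete⁻ e M del in f≢e (matched-unique isM Mf Me if ie)

  matched-disjoint : ∀ {M v e f} → IsMatching G M → M e ≡ true → M f ≡ true → e ≢ f → Inc G v e → ¬ Inc G v f
  matched-disjoint isM Me Mf e≢f v∈e v∈f = e≢f (matched-unique isM Me Mf v∈e v∈f)

  insert-exposed : ∀ {M v e} → Exposed G v M → ¬ Inc G v e → Exposed G v (insert e M)
  insert-exposed {M} {e = e} exp v∉e f ins v∈f with insert⁻ e M ins
  ... | inj₁ refl = v∉e v∈f
  ... | inj₂ Mf   = exp f Mf v∈f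

  ind-∨ : ∀ x y q → (x ∧ y) ≡ false → ind (x ∨ y) q ≡ ind x q + ind y q
  ind-∨ true  false q _ = sym (+-identityʳ q)
  ind-∨ false y     q _ = sym (+-identityˡ (ind y q))

  Σ-incident : ∀ e (f : Vtx G → ℚ) → Σℚ (n G) (λ v → ind (does (inc? v e)) (f v)) ≡ f (end₁ e) + f (end₂ e)
  Σ-incident e f = begin
    Σℚ (n G) (λ v → ind (does (inc? v e)) (f v))
      ≡⟨ Σℚ-cong (λ v → ind-∨ (does (end₁ e ≟ᶠ v)) (does (end₂ e ≟ᶠ v)) (f v) (not-both v)) ⟩
    Σℚ (n G) (λ v → ind (does (end₁ e ≟ᶠ v)) (f v) + ind (does (end₂ e ≟ᶠ v)) (f v))
      ≡⟨ Σℚ-+ {n G} _ _ ⟩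
    Σℚ (n G) (λ v → ind (does (end₁ e ≟ᶠ v)) (f v)) + Σℚ (n G) (λ v → ind (does (end₂ e ≟ᶠ v)) (f v))
      ≡⟨ cong₂ _+_ (Σℚ-pick (end₁ e) f) (Σℚ-pick (end₂ e) f) ⟩
    f (end₁ e) + f (end₂ e) ∎
    where
    open ≡-Reasoning
    not-both : ∀ v → does (end₁ e ≟ᶠ v) ∧ does (end₂ e ≟ᶠ v) ≡ false
    not-both v with end₁ e ≟ᶠ v | end₂ e ≟ᶠ v
    ... | yes refl | yes e₂≡v = ⊥-elim (end₁≢end₂ e (sym e₂≡v))
    ... | yes _    | no  _    = refl
    ... | no  _    | _        = refl

  Σ-matched-at : ∀ {M} → IsMatching G M → ∀ v q →
                 Σℚ (m G) (λ e → ind (M e ∧ does (inc? v e)) q) ≡ ind (covers M v) q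
  Σ-matched-at {M} isM v q with covered? M v
  ... | no ¬cov = Σℚ-zero (λ e → none e (inc? v e))
    where
    none : ∀ e (i? : Dec (Inc G v e)) → ind (M e ∧ does i?) q ≡ 0ℚ
    none e i? with M e in Me | i?
    ... | true  | yes i = ⊥-elim (¬cov (e , Me , i))
    ... | true  | no  _ = refl
    ... | false | _     = refl
  ... | yes (e₀ , Me₀ , i₀) = trans (Σℚ-cong (λ e → only-e₀ e (inc? v e))) (Σℚ-pick e₀ (λ _ → q))
    where
    only-e₀ : ∀ e (i? : Dec (Inc G v e)) → ind (M e ∧ does i?) q ≡ ind (does (e₀ ≟ᶠ e)) q
    only-e₀ e i? with M e in Me | i? | e₀ ≟ᶠ e
    ... | true  | yes i  | yes _    = refl
    ... | true  | yes i  | no  e₀≢e = ⊥-elim (e₀≢e (matched-unique isM Me₀ Me i₀ i))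
    ... | true  | no  ¬i | yes refl = ⊥-elim (¬i i₀)
    ... | true  | no  _  | no  _    = refl
    ... | false | _      | yes refl = ⊥-elim (not-¬ Me₀ Me)
    ... | false | _      | no  _    = refl

  handshake : ∀ {M} → IsMatching G M → (f : Vtx G → ℚ) →
    Σℚ (m G) (λ e → ind (M e) (f (end₁ e) + f (end₂ e))) ≡ Σℚ (n G) (λ v → ind (covers M v) (f v))
  handshake {M} isM f = begin
    Σℚ (m G) (λ e → ind (M e) (f (end₁ e) + f (end₂ e)))
      ≡⟨ Σℚ-cong (λ e → cong (ind (M e)) (sym (Σ-incident e f))) ⟩
    Σℚ (m G) (λ e → ind (M e) (Σℚ (n G) (λ v → ind (does (inc? v e)) (f v))))
      ≡⟨ Σℚ-cong (λ e → ind-Σℚ (M e) (λ v → does (inc? v e)) f) ⟩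
    Σℚ (m G) (λ e → Σℚ (n G) (λ v → ind (M e ∧ does (inc? v e)) (f v)))
      ≡⟨ Σℚ-comm (m G) (n G) _ ⟩
    Σℚ (n G) (λ v → Σℚ (m G) (λ e → ind (M e ∧ does (inc? v e)) (f v)))
      ≡⟨ Σℚ-cong (λ v → Σ-matched-at isM v (f v)) ⟩
    Σℚ (n G) (λ v → ind (covers M v) (f v)) ∎
    where
    open ≡-Reasoning
    ind-Σℚ : ∀ b (c : Vtx G → Bool) (g : Vtx G → ℚ) →
             ind b (Σℚ (n G) (λ v → ind (c v) (g v))) ≡ Σℚ (n G) (λ v → ind (b ∧ c v) (g v))
    ind-Σℚ true  c g = refl
    ind-Σℚ false c g = sym (Σℚ-zero {n G} (λ _ → refl))

  record Admissible (M : EdgeSet G) (y : Vtx G → ℚ) : Set where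
    field
      matching  : IsMatching G M
      nonneg    : ∀ v → 0ℚ ≤ y v
      covering  : ∀ e → 1ℚ ≤ y (end₁ e) + y (end₂ e)
      vanishing : ∀ v → Exposed G v M → y v ≡ 0ℚ

  excess : EdgeSet G → (Vtx G → ℚ) → ℚ
  excess M y = Σℚ (n G) y - fromℕ (size G M)

  slack : EdgeSet G → (Vtx G → ℚ) → Edge G → ℚ
  slack M y e = ind (M e) (y (end₁ e) + y (end₂ e) - 1ℚ)

  Minimal : EdgeSet G → (Vtx G → ℚ) → Set
  Minimal M y = Admissible M y × (∀ M′ y′ → Admissible M′ y′ → excess M y ≤ excess M′ y′)

  Σ-covered : ∀ {M} (y : Vtx G → ℚ) → (∀ v → Exposed G v M → y v ≡ 0ℚ) →
              Σℚ (n G) (λ v → ind (covers M v) (y v)) ≡ Σℚ (n G) y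
  Σ-covered {M} y vanishing = Σℚ-cong (λ v → pointwise v (covered? M v))
    where
    pointwise : ∀ v (c? : Dec (Covered M v)) → ind (does c?) (y v) ≡ y v
    pointwise v (yes _)    = refl
    pointwise v (no ¬cov) = sym (vanishing v (¬Covered⇒Exposed ¬cov))

  Σ-endpoints : ∀ {M} → IsMatching G M → (y : Vtx G → ℚ) → (∀ v → Exposed G v M → y v ≡ 0ℚ) →
                Σℚ (m G) (λ e → ind (M e) (y (end₁ e) + y (end₂ e))) ≡ Σℚ (n G) y
  Σ-endpoints isM y vanishing = trans (handshake isM y) (Σ-covered y vanishing)

  ind-1+ : ∀ b p → ind b (1ℚ + p) ≡ ind b 1ℚ + ind b p
  ind-1+ true  p = refl
  ind-1+ false p = refl

  module _ {M : EdgeSet G} {y : Vtx G → ℚ} where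

    Σ-matched-1+ : (c : Edge G → ℚ) →
                   Σℚ (m G) (λ e → ind (M e) (1ℚ + c e)) ≡ fromℕ (size G M) + Σℚ (m G) (λ e → ind (M e) (c e))
    Σ-matched-1+ c = trans (Σℚ-cong (λ e → ind-1+ (M e) (c e)))
        (trans (Σℚ-+ {m G} _ _) (cong (_+ Σℚ (m G) (λ e → ind (M e) (c e))) (Σℚ-count (m G) M)))

    admissible⇒feasible : Admissible M y → Feasible G M y (slack M y)
    admissible⇒feasible adm =
      (λ e → ind-nonneg (M e) (p≤q⇒0≤q-p (covering e))) , matching , (nonneg , covers-1+slack) ,
      trans (Σℚ-cong 1+slack) (Σ-endpoints matching y vanishing)
      where
      open Admissible adm
      1+[s-1] : ∀ s → 1ℚ + (s - 1ℚ) ≡ s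
      1+[s-1] = solve 1 (λ s → con 1ℚ :+ (s :- con 1ℚ) := s) refl
      covers-1+slack : ∀ e → 1ℚ + slack M y e ≤ y (end₁ e) + y (end₂ e)
      covers-1+slack e with M e
      ... | true  = ≤-reflexive (1+[s-1] _)
      ... | false = covering e
      1+slack : ∀ e → (if M e then 1ℚ + slack M y e else 0ℚ) ≡ ind (M e) (y (end₁ e) + y (end₂ e))
      1+slack e with M e
      ... | true  = 1+[s-1] _
      ... | false = refl

    Σ-on-matching : (c : Edge G → ℚ) → matchWeight G M c ≡ Σℚ (n G) y →
                    Σℚ (m G) (λ e → ind (M e) (c e)) ≡ excess M y
    Σ-on-matching c weight = solve-for (trans (sym (Σ-matched-1+ c)) weight)
      where
      solve-for : ∀ {a b s} → a + b ≡ s → b ≡ s - a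
      solve-for {a} {b} refl = solve 2 (λ a b → b := a :+ b :- a) refl a b

    Σ-slack : Admissible M y → Σℚ (m G) (slack M y) ≡ excess M y
    Σ-slack adm = trans (Σℚ-cong λ e → ind-idem (M e))
        (Σ-on-matching (slack M y) (proj₂ (proj₂ (proj₂ (admissible⇒feasible adm)))))
      where
      ind-idem : ∀ b {p} → ind b p ≡ ind b (ind b p)
      ind-idem true  = refl
      ind-idem false = refl

    module Feasible⇒ {c : Edge G → ℚ} (feas : Feasible G M y c) where

      private
        c-nonneg = proj₁ feas
        isM      = proj₁ (proj₂ feas)
        y-nonneg = proj₁ (proj₁ (proj₂ (proj₂ feas)))
        cover    = proj₂ (proj₁ (proj₂ (proj₂ feas)))
        weight   = proj₂ (proj₂ (proj₂ feas))

        ends-sum : Edge G → ℚ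
        ends-sum e = y (end₁ e) + y (end₂ e)

        weight≤ : ∀ e → ind (M e) (1ℚ + c e) ≤ ind (M e) (ends-sum e)
        weight≤ e = ind-mono-≤ (M e) (cover e)

        covered≤ : ∀ v → ind (covers M v) (y v) ≤ y v
        covered≤ v = ind-≤ (covers M v) (y-nonneg v)

        Σweight≤ : Σℚ (m G) (λ e → ind (M e) (1ℚ + c e)) ≤ Σℚ (m G) (λ e → ind (M e) (ends-sum e))
        Σweight≤ = Σℚ-mono-≤ weight≤

        Σcovered≤ : Σℚ (n G) (λ v → ind (covers M v) (y v)) ≤ Σℚ (n G) y
        Σcovered≤ = Σℚ-mono-≤ covered≤

      admissible : Admissible M y
      admissible = record
        { matching  = isM
        ; nonneg    = y-nonneg
        ; covering  = λ e → ≤-trans (p≤p+q (c-nonneg e)) (cover e)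
        ; vanishing = λ v exp → trans (sym (covered-tight v))
            (cong (λ b → ind b (y v)) (dec-false (covered? M v) (Exposed⇒¬Covered exp)))
        }
        where
        covered-tight : ∀ v → ind (covers M v) (y v) ≡ y v
        covered-tight = Σℚ-≤-tight covered≤
          (≤-trans (≤-reflexive (sym weight)) (≤-trans Σweight≤ (≤-reflexive (handshake isM y))))

      tight : ∀ e → M e ≡ true → c e ≡ y (end₁ e) + y (end₂ e) - 1ℚ
      tight e Me = trans (solve 1 (λ x → x := con 1ℚ :+ x :- con 1ℚ) refl (c e))
                         (cong (_- 1ℚ) (subst (λ b → ind b (1ℚ + c e) ≡ ind b (ends-sum e)) Me (weight-tight e)))
        where
        weight-tight : ∀ e → ind (M e) (1ℚ + c e) ≡ ind (M e) (ends-sum e)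
        weight-tight = Σℚ-≤-tight weight≤
          (≤-trans (≤-reflexive (handshake isM y)) (≤-trans Σcovered≤ (≤-reflexive (sym weight))))

      Σ-on-M : Σℚ (m G) (λ e → ind (M e) (c e)) ≡ excess M y
      Σ-on-M = Σ-on-matching c weight

      excess≤Σ : excess M y ≤ Σℚ (m G) c
      excess≤Σ = ≤-trans (≤-reflexive (sym Σ-on-M)) (Σℚ-mono-≤ (λ e → ind-≤ (M e) (c-nonneg e)))

  optimal⇒minimal : ∀ {M y c} → Optimal G M y c → Minimal M y
  optimal⇒minimal (feas , opt) =
    admissible , λ M′ y′ adm′ → ≤-trans excess≤Σ
        (≤-trans (opt M′ y′ _ (admissible⇒feasible adm′)) (≤-reflexive (Σ-slack adm′)))
    where open Feasible⇒ feas

  minimal⇒optimal : ∀ {M y} → Minimal M y → Optimal G M y (slack M y)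
  minimal⇒optimal (adm , min) =
    admissible⇒feasible adm ,
    λ M′ y′ c′ feas′ → ≤-trans (≤-reflexive (Σ-slack adm))
        (≤-trans (min M′ y′ (Feasible⇒.admissible feas′)) (Feasible⇒.excess≤Σ feas′))

  minimal-≮ : ∀ {M y M′ y′} → Minimal M y → Admissible M′ y′ → ¬ (excess M′ y′ < excess M y)
  minimal-≮ (_ , min) adm′ lt = <-irrefl refl (<-≤-trans lt (min _ _ adm′))

  excess-monoʳ-< : ∀ M {y y′} → Σℚ (n G) y′ < Σℚ (n G) y → excess M y′ < excess M y
  excess-monoʳ-< M = +-monoˡ-< (- fromℕ (size G M))

  excess-antimonoˡ-< : ∀ {M M′} y → size G M ℕ.< size G M′ → excess M′ y < excess M y
  excess-antimonoˡ-< y lt = +-monoʳ-< (Σℚ (n G) y) (neg-antimono-< (fromℕ-mono-< lt))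

  VSet : Set
  VSet = Vtx G → Bool

  switch : EdgeSet G → EdgeSet G → EdgeSet G → EdgeSet G
  switch P X Y e = if P e then Y e else X e

  Augmentation : EdgeSet G → Set
  Augmentation M = ∃ λ M′ → IsMatching G M′ × size G M ℕ.< size G M′ × (∀ v → Exposed G v M′ → Exposed G v M)

  distance : EdgeSet G → EdgeSet G → ℕ
  distance M N = count (m G) (λ e → M e xor N e)

  -- P is the edge set of an alternating walk from w₀ to s that starts with an N-edge, and switch P M N,
  -- switch P N M flip the walk in M and in N. If the N-edge at s leads to an M-exposed vertex, flipping
  -- it too augments M; if s has no N-edge, the flipped N is closer to M; otherwise the walk grows.
  module AlternatingWalk {M N : EdgeSet G} (isM : IsMatching G M) (isN : IsMatching G N)
                         {w₀ : Vtx G} (w₀-exposed : Exposed G w₀ M) (w₀-covered : Covered N w₀) where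

    Closer : Set
    Closer = ∃ λ N′ → IsMatching G N′ × size G N′ ≡ size G N × distance M N′ ℕ.< distance M N

    record Path (W : VSet) (P : EdgeSet G) (s : Vtx G) : Set where
      field
        w₀∈W   : W w₀ ≡ true
        s∈W    : W s ≡ true
        P⊆W    : ∀ {e x} → P e ≡ true → Inc G x e → W x ≡ true
        M-path : ∀ {x} → W x ≡ true → x ≢ w₀ → ∃ λ e → M e ≡ true × P e ≡ true × Inc G x e
        N-path : ∀ {x} → W x ≡ true → x ≢ s → ∃ λ e → N e ≡ true × P e ≡ true × Inc G x e × ¬ Inc G s e
        size-A : size G (switch P M N) ≡ size G M
        size-B : size G (switch P N M) ≡ size G N

    start : Path (insert w₀ (λ _ → false)) (λ _ → false) w₀
    start = record
      { w₀∈W   = insert-≡ w₀ _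
      ; s∈W    = insert-≡ w₀ _
      ; P⊆W    = λ ()
      ; M-path = λ x∈W x≢w₀ → ⊥-elim (x≢w₀ (only-w₀ x∈W))
      ; N-path = λ x∈W x≢w₀ → ⊥-elim (x≢w₀ (only-w₀ x∈W))
      ; size-A = refl
      ; size-B = refl
      }
      where
      only-w₀ : ∀ {x} → insert w₀ (λ _ → false) x ≡ true → x ≡ w₀
      only-w₀ x∈W with insert⁻ w₀ _ x∈W
      ... | inj₁ x≡w₀ = x≡w₀

    module _ {W P s} (path : Path W P s) where
      open Path path

      M-edge-on-path : ∀ {e x} → M e ≡ true → Inc G x e → W x ≡ true → P e ≡ true
      M-edge-on-path {e} {x} Me x∈e x∈W with x ≟ᶠ w₀
      ... | yes refl = ⊥-elim (w₀-exposed e Me x∈e)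
      ... | no  x≢w₀ =
        let e′ , Me′ , Pe′ , x∈e′ = M-path x∈W x≢w₀
        in subst (λ f → P f ≡ true) (matched-unique isM Me′ Me x∈e′ x∈e) Pe′

      N-edge-on-path : ∀ {e x} → N e ≡ true → Inc G x e → W x ≡ true → x ≢ s → P e ≡ true
      N-edge-on-path Ne x∈e x∈W x≢s =
        let e′ , Ne′ , Pe′ , x∈e′ , _ = N-path x∈W x≢s
        in subst (λ f → P f ≡ true) (matched-unique isN Ne′ Ne x∈e′ x∈e) Pe′

      N-edge-leaves : ∀ {e x} → N e ≡ true → Inc G s e → Inc G x e → W x ≡ true → x ≡ s
      N-edge-leaves {e} {x} Ne s∈e x∈e x∈W with x ≟ᶠ s
      ... | yes x≡s = x≡s
      ... | no  x≢s =
        let e′ , Ne′ , _ , x∈e′ , s∉e′ = N-path x∈W x≢s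
        in ⊥-elim (s∉e′ (subst (Inc G s) (matched-unique isN Ne Ne′ x∈e x∈e′) s∈e))

      A-matching : IsMatching G (switch P M N)
      A-matching e f Ae Af e≢f v v∈e v∈f with P e in Pe | P f in Pf
      ... | true  | true  = isN e f Ae Af e≢f v v∈e v∈f
      ... | false | false = isM e f Ae Af e≢f v v∈e v∈f
      ... | true  | false = not-¬ (M-edge-on-path Af v∈f (P⊆W Pe v∈e)) Pf
      ... | false | true  = not-¬ (M-edge-on-path Ae v∈e (P⊆W Pf v∈f)) Pe

      B-matching : Exposed G s N → IsMatching G (switch P N M)
      B-matching s-exposed e f Be Bf e≢f v v∈e v∈f with P e in Pe | P f in Pf
      ... | true  | true  = isM e f Be Bf e≢f v v∈e v∈f
      ... | false | false = isN e f Be Bf e≢f v v∈e v∈f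
      ... | true  | false =
        not-¬ (N-edge-on-path Bf v∈f (P⊆W Pe v∈e) (exposed-≢ s-exposed Bf v∈f)) Pf
      ... | false | true  =
        not-¬ (N-edge-on-path Be v∈e (P⊆W Pf v∈f) (exposed-≢ s-exposed Be v∈e)) Pe

      shrink : Exposed G s N → Closer
      shrink s-exposed =
        switch P N M , B-matching s-exposed , size-B , count-mono-< (m G) fewer h₀ agree differ
        where
        h₀ = proj₁ w₀-covered
        Nh₀ = proj₁ (proj₂ w₀-covered)
        w₀∈h₀ = proj₂ (proj₂ w₀-covered)
        fewer : ∀ e → (M e xor switch P N M e) ≡ true → (M e xor N e) ≡ true
        fewer e with P e
        ... | true  = λ same → ⊥-elim (not-¬ same (xor-same (M e)))
        ... | false = id
        agree : (M h₀ xor switch P N M h₀) ≡ false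
        agree rewrite N-edge-on-path Nh₀ w₀∈h₀ w₀∈W (exposed-≢ s-exposed Nh₀ w₀∈h₀) = xor-same (M h₀)
        differ : (M h₀ xor N h₀) ≡ true
        differ rewrite ¬-not (λ Mh₀ → w₀-exposed h₀ Mh₀ w₀∈h₀) | Nh₀ = refl

      module Step {h} (Nh : N h ≡ true) (s∈h : Inc G s h) where

        t : Vtx G
        t = opposite s∈h

        t∈h : Inc G t h
        t∈h = Inc-opposite s∈h

        t∉W : W t ≡ false
        t∉W = ¬-not (λ t∈W → opposite≢ s∈h (N-edge-leaves Nh s∈h t∈h t∈W))

        h∉P : P h ≡ false
        h∉P = ¬-not (λ Ph → not-¬ (P⊆W Ph t∈h) t∉W)

        A : EdgeSet G
        A = switch P M N

        A-exposed : ∀ {x} → Exposed G t M → Inc G x h → Exposed G x A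
        A-exposed t-exposed x∈h e Ae x∈e with Inc-ends s∈h x∈h | P e in Pe
        ... | inj₁ refl | true  = not-¬ (subst (λ f → P f ≡ true) (matched-unique isN Ae Nh x∈e s∈h) Pe) h∉P
        ... | inj₁ refl | false = not-¬ (M-edge-on-path Ae x∈e s∈W) Pe
        ... | inj₂ refl | true  = not-¬ (P⊆W Pe x∈e) t∉W
        ... | inj₂ refl | false = t-exposed e Ae x∈e

        augment : Exposed G t M → Augmentation M
        augment t-exposed =
          insert h A ,
          insert-matching h A-matching (A-exposed t-exposed (inc₁ h)) (A-exposed t-exposed (inc₂ h)) ,
          subst (ℕ._< size G (insert h A)) size-A (subst (size G A ℕ.<_) (sym (count-insert (m G) A h Ah)) (ℕ.n<1+n _)) ,
          keeps-covered
          where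
          Ah : A h ≡ false
          Ah rewrite h∉P = ¬-not (λ Mh → t-exposed h Mh t∈h)
          keeps-covered : ∀ v → Exposed G v (insert h A) → Exposed G v M
          keeps-covered v exp e Me v∈e with P e in Pe
          ... | false = exp e (insert⁺ h A (subst (λ b → (if b then N e else M e) ≡ true) (sym Pe) Me)) v∈e
          ... | true with v ≟ᶠ s
          ...   | yes refl = exp h (insert-≡ h A) s∈h
          ...   | no  v≢s =
            let e′ , Ne′ , Pe′ , v∈e′ , _ = N-path (P⊆W Pe v∈e) v≢s
            in exp e′ (insert⁺ h A (subst (λ b → (if b then N e′ else M e′) ≡ true) (sym Pe′) Ne′)) v∈e′

        module Extend {g} (Mg : M g ≡ true) (t∈g : Inc G t g) where

          s₂ : Vtx G
          s₂ = opposite t∈g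

          s₂∈g : Inc G s₂ g
          s₂∈g = Inc-opposite t∈g

          g∉P : P g ≡ false
          g∉P = ¬-not (λ Pg → not-¬ (P⊆W Pg t∈g) t∉W)

          s₂∉W : W s₂ ≡ false
          s₂∉W = ¬-not (λ s₂∈W → not-¬ (M-edge-on-path Mg s₂∈g s₂∈W) g∉P)

          s₂∉h : ¬ Inc G s₂ h
          s₂∉h s₂∈h with Inc-ends s∈h s₂∈h
          ... | inj₁ s₂≡s = not-¬ s∈W (trans (cong W (sym s₂≡s)) s₂∉W)
          ... | inj₂ s₂≡t = opposite≢ t∈g s₂≡t

          g≢h : g ≢ h
          g≢h refl = s₂∉h s₂∈g

          Mh : M h ≡ false
          Mh = ¬-not (λ Mh → g≢h (matched-unique isM Mg Mh t∈g t∈h))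

          Ng : N g ≡ false
          Ng = ¬-not (λ Ng → g≢h (matched-unique isN Ng Nh t∈g t∈h))

          W′ : VSet
          W′ = insert t (insert s₂ W)

          P′ : EdgeSet G
          P′ = insert h (insert g P)

          W⊆W′ : ∀ {x} → W x ≡ true → W′ x ≡ true
          W⊆W′ x∈W = insert⁺ t _ (insert⁺ s₂ W x∈W)

          P⊆P′ : ∀ {e} → P e ≡ true → P′ e ≡ true
          P⊆P′ Pe = insert⁺ h _ (insert⁺ g P Pe)

          t∈W′ : W′ t ≡ true
          t∈W′ = insert-≡ t _

          s₂∈W′ : W′ s₂ ≡ true
          s₂∈W′ = insert⁺ t _ (insert-≡ s₂ W)

          h∈P′ : P′ h ≡ true
          h∈P′ = insert-≡ h _

          g∈P′ : P′ g ≡ true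
          g∈P′ = insert⁺ h _ (insert-≡ g P)

          W′-cases : ∀ {x} → W′ x ≡ true → x ≡ t ⊎ x ≡ s₂ ⊎ W x ≡ true
          W′-cases x∈W′ with insert⁻ t _ x∈W′
          ... | inj₁ x≡t = inj₁ x≡t
          ... | inj₂ x∈W″ with insert⁻ s₂ W x∈W″
          ...   | inj₁ x≡s₂ = inj₂ (inj₁ x≡s₂)
          ...   | inj₂ x∈W  = inj₂ (inj₂ x∈W)

          P′-cases : ∀ {e} → P′ e ≡ true → e ≡ h ⊎ e ≡ g ⊎ P e ≡ true
          P′-cases Pe with insert⁻ h _ Pe
          ... | inj₁ e≡h = inj₁ e≡h
          ... | inj₂ Pe″ with insert⁻ g P Pe″
          ...   | inj₁ e≡g = inj₂ (inj₁ e≡g)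
          ...   | inj₂ Pe  = inj₂ (inj₂ Pe)

          P′-≢ : ∀ {e} → e ≢ h → e ≢ g → P′ e ≡ P e
          P′-≢ e≢h e≢g = trans (insert-≢ _ e≢h) (insert-≢ P e≢g)

          A′≗ : ∀ e → switch P′ M N e ≡ insert h (delete g A) e
          A′≗ e with e ≟ᶠ h | e ≟ᶠ g
          ... | yes refl | _        rewrite h∈P′ | insert-≡ h (delete g A) = Nh
          ... | no  e≢h  | yes refl rewrite g∈P′ | insert-≢ (delete g A) e≢h | delete-≡ g A = Ng
          ... | no  e≢h  | no  e≢g  rewrite P′-≢ e≢h e≢g | insert-≢ (delete g A) e≢h | delete-≢ A e≢g = refl

          B′≗ : ∀ e → switch P′ N M e ≡ insert g (delete h (switch P N M)) e
          B′≗ e with e ≟ᶠ h | e ≟ᶠ g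
          ... | yes refl | _        rewrite h∈P′ | insert-≢ (delete h (switch P N M)) (λ h≡g → g≢h (sym h≡g)) | delete-≡ h (switch P N M)
              = Mh
          ... | no  e≢h  | yes refl rewrite g∈P′ | insert-≡ g (delete h (switch P N M)) = Mg
          ... | no  e≢h  | no  e≢g  rewrite P′-≢ e≢h e≢g | insert-≢ (delete h (switch P N M)) e≢g | delete-≢ (switch P N M) e≢h
              = refl

          Ah : A h ≡ false
          Ah = trans (cong (λ b → if b then N h else M h) h∉P) Mh

          size-A′ : size G (switch P′ M N) ≡ size G M
          size-A′ = begin
            size G (switch P′ M N)         ≡⟨ count-cong (m G) A′≗ ⟩
            size G (insert h (delete g A)) ≡⟨ count-insert (m G) _ h (trans (delete-≢ A (λ h≡g → g≢h (sym h≡g))) Ah) ⟩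
            suc (size G (delete g A))      ≡⟨ count-delete (m G) A g (trans (cong (λ b → if b then N g else M g) g∉P) Mg) ⟩
            size G A                       ≡⟨ size-A ⟩
            size G M                       ∎
            where open ≡-Reasoning

          size-B′ : size G (switch P′ N M) ≡ size G N
          size-B′ = begin
            size G (switch P′ N M)         ≡⟨ count-cong (m G) B′≗ ⟩
            size G (insert g (delete h B))
              ≡⟨ count-insert (m G) _ g (trans (delete-≢ B g≢h) (trans (cong (λ b → if b then M g else N g) g∉P) Ng)) ⟩
            suc (size G (delete h B))      ≡⟨ count-delete (m G) B h (trans (cong (λ b → if b then M h else N h) h∉P) Nh) ⟩
            size G B                       ≡⟨ size-B ⟩
            size G N                       ∎
            where
            open ≡-Reasoning
            B = switch P N M

          P′⊆W′ : ∀ {e x} → P′ e ≡ true → Inc G x e → W′ x ≡ true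
          P′⊆W′ Pe x∈e with P′-cases Pe
          ... | inj₁ refl with Inc-ends s∈h x∈e
          ...   | inj₁ refl = W⊆W′ s∈W
          ...   | inj₂ refl = t∈W′
          P′⊆W′ Pe x∈e | inj₂ (inj₁ refl) with Inc-ends t∈g x∈e
          ...   | inj₁ refl = t∈W′
          ...   | inj₂ refl = s₂∈W′
          P′⊆W′ _ x∈e | inj₂ (inj₂ Pe) = W⊆W′ (P⊆W Pe x∈e)

          M-path′ : ∀ {x} → W′ x ≡ true → x ≢ w₀ → ∃ λ e → M e ≡ true × P′ e ≡ true × Inc G x e
          M-path′ x∈W′ x≢w₀ with W′-cases x∈W′
          ... | inj₁ refl        = g , Mg , g∈P′ , t∈g
          ... | inj₂ (inj₁ refl) = g , Mg , g∈P′ , s₂∈g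
          ... | inj₂ (inj₂ x∈W)  = let e , Me , Pe , x∈e = M-path x∈W x≢w₀ in e , Me , P⊆P′ Pe , x∈e

          N-path′ : ∀ {x} → W′ x ≡ true → x ≢ s₂
              → ∃ λ e → N e ≡ true × P′ e ≡ true × Inc G x e × ¬ Inc G s₂ e
          N-path′ {x} x∈W′ x≢s₂ with W′-cases x∈W′
          ... | inj₁ refl        = h , Nh , h∈P′ , t∈h , s₂∉h
          ... | inj₂ (inj₁ x≡s₂) = ⊥-elim (x≢s₂ x≡s₂)
          ... | inj₂ (inj₂ x∈W) with x ≟ᶠ s
          ...   | yes refl = h , Nh , h∈P′ , s∈h , s₂∉h
          ...   | no  x≢s  =
            let e , Ne , Pe , x∈e , _ = N-path x∈W x≢s
            in e , Ne , P⊆P′ Pe , x∈e , λ s₂∈e → not-¬ (P⊆W Pe s₂∈e) s₂∉W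

          path′ : Path W′ P′ s₂
          path′ = record
            { w₀∈W = W⊆W′ w₀∈W ; s∈W = s₂∈W′ ; P⊆W = P′⊆W′ ; M-path = M-path′ ; N-path = N-path′
            ; size-A = size-A′ ; size-B = size-B′
            }

          grows : count (n G) W ℕ.< count (n G) W′
          grows = count-mono-< (n G) (λ _ → W⊆W′) t t∉W t∈W′

    walk : ∀ {W P s} → Path W P s → Acc ℕ._<_ (n G ∸ count (n G) W) → Augmentation M ⊎ Closer
    walk {s = s} path (acc further) with covered? N s
    ... | no  ¬cov = inj₂ (shrink path (¬Covered⇒Exposed ¬cov))
    ... | yes (h , Nh , s∈h) with covered? M (Step.t path Nh s∈h)
    ...   | no  ¬cov = inj₁ (Step.augment path Nh s∈h (¬Covered⇒Exposed ¬cov))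
    ...   | yes (g , Mg , t∈g) =
      walk path′ (further (ℕ.∸-monoʳ-< grows (count-≤ (n G) _)))
      where open Step.Extend path Nh s∈h Mg t∈g

  Σ-covered-ones : ∀ {X} → IsMatching G X →
                   Σℚ (n G) (λ v → ind (covers X v) 1ℚ) ≡ fromℕ (size G X) + fromℕ (size G X)
  Σ-covered-ones {X} isX = begin
    Σℚ (n G) (λ v → ind (covers X v) 1ℚ)                          ≡⟨ sym (handshake isX (λ _ → 1ℚ)) ⟩
    Σℚ (m G) (λ e → ind (X e) (1ℚ + 1ℚ))                          ≡⟨ Σℚ-cong (λ e → ind-double (X e)) ⟩
    Σℚ (m G) (λ e → ind (X e) 1ℚ + ind (X e) 1ℚ)                  ≡⟨ Σℚ-+ {m G} _ _ ⟩
    Σℚ (m G) (λ e → ind (X e) 1ℚ) + Σℚ (m G) (λ e → ind (X e) 1ℚ)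
      ≡⟨ cong₂ _+_ (Σℚ-count (m G) X) (Σℚ-count (m G) X) ⟩
    fromℕ (size G X) + fromℕ (size G X)                           ∎
    where
    open ≡-Reasoning
    ind-double : ∀ b → ind b (1ℚ + 1ℚ) ≡ ind b 1ℚ + ind b 1ℚ
    ind-double true  = refl
    ind-double false = refl

  exposed-covered-by-larger : ∀ {M N} → IsMatching G M → IsMatching G N → size G M ℕ.< size G N →
                              ∃ λ w → Exposed G w M × Covered N w
  exposed-covered-by-larger {M} {N} isM isN |M|<|N| =
    let w , lt = Σℚ-<⇒∃ (subst₂ _<_ (sym (Σ-covered-ones isM)) (sym (Σ-covered-ones isN)) (+-mono-< |M|<|N|ℚ |M|<|N|ℚ))
    in w , decide (covered? M w) (covered? N w) lt
    where
    |M|<|N|ℚ = fromℕ-mono-< |M|<|N|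
    decide : ∀ {w} (m? : Dec (Covered M w)) (n? : Dec (Covered N w)) →
             ind (does m?) 1ℚ < ind (does n?) 1ℚ → Exposed G w M × Covered N w
    decide (no ¬covM) (yes covN) _ = ¬Covered⇒Exposed ¬covM , covN
    decide (yes _) (yes _) lt = ⊥-elim (<-irrefl refl lt)
    decide (yes _) (no _) lt = ⊥-elim (<-asym lt 0<1)
    decide (no _) (no _) lt = ⊥-elim (<-irrefl refl lt)

  augmenting : ∀ {M N} → IsMatching G M → IsMatching G N → size G M ℕ.< size G N → Augmentation M
  augmenting {M} isM isN |M|<|N| = go isN |M|<|N| (<-wellFounded _)
    where
    go : ∀ {N} → IsMatching G N → size G M ℕ.< size G N → Acc ℕ._<_ (distance M N) → Augmentation M
    go isN |M|<|N| (acc closer) = finish (walk start (<-wellFounded _))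
      where
      found = exposed-covered-by-larger isM isN |M|<|N|
      open AlternatingWalk isM isN (proj₁ (proj₂ found)) (proj₂ (proj₂ found))
      finish : Augmentation M ⊎ Closer → Augmentation M
      finish (inj₁ augmentation)                   = augmentation
      finish (inj₂ (N′ , isN′ , same-size , nearer)) = go isN′ (subst (size G M ℕ.<_) (sym same-size) |M|<|N|) (closer nearer)

  cap : (Vtx G → ℚ) → Vtx G → ℚ
  cap y v = y v ⊓ 1ℚ

  ⊓1-covers : ∀ {p q} → 0ℚ ≤ p → 0ℚ ≤ q → 1ℚ ≤ p + q → 1ℚ ≤ p ⊓ 1ℚ + q ⊓ 1ℚ
  ⊓1-covers {p} {q} 0≤p 0≤q 1≤p+q with p ≤? 1ℚ | q ≤? 1ℚ
  ... | yes p≤1 | yes q≤1 rewrite p≤q⇒p⊓q≡p p≤1 | p≤q⇒p⊓q≡p q≤1 = 1≤p+q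
  ... | yes p≤1 | no  q≰1 rewrite p≤q⇒p⊓q≡p p≤1 | p≥q⇒p⊓q≡q (<⇒≤ (≰⇒> q≰1))
      = subst (1ℚ ≤_) (+-comm 1ℚ p) (1≤1+p 0≤p)
  ... | no  p≰1 | _       rewrite p≥q⇒p⊓q≡q (<⇒≤ (≰⇒> p≰1)) = 1≤1+p (⊓-glb 0≤q (<⇒≤ 0<1))

  cap-admissible : ∀ {M y} → Admissible M y → Admissible M (cap y)
  cap-admissible adm = record
    { matching  = matching
    ; nonneg    = λ v → ⊓-glb (nonneg v) (<⇒≤ 0<1)
    ; covering  = λ e → ⊓1-covers (nonneg _) (nonneg _) (covering e)
    ; vanishing = λ v exp → cong (_⊓ 1ℚ) (vanishing v exp)
    }
    where open Admissible adm

  Σ-cap-< : ∀ {y w} → 1ℚ < y w → Σℚ (n G) (cap y) < Σℚ (n G) y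
  Σ-cap-< {y} {w} 1<yw = Σℚ-mono-< (λ v → p⊓q≤p (y v) 1ℚ) w (subst (_< y w) (sym (p≥q⇒p⊓q≡q (<⇒≤ 1<yw))) 1<yw)

  minimal-≤1 : ∀ {M y} → Minimal M y → ∀ v → y v ≤ 1ℚ
  minimal-≤1 {M} {y} min v with y v ≤? 1ℚ
  ... | yes yv≤1 = yv≤1
  ... | no  yv≰1 = ⊥-elim (minimal-≮ min (cap-admissible (proj₁ min)) (excess-monoʳ-< M (Σ-cap-< (≰⇒> yv≰1))))

  minimal-maximum : ∀ {M y} → Minimal M y → IsMaxCardMatching G M
  minimal-maximum {M} {y} min = matching , larger-impossible
    where
    open Admissible (proj₁ min)
    larger-impossible : ∀ M′ → IsMatching G M′ → size G M′ ℕ.≤ size G M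
    larger-impossible M′ isM′ with size G M′ ℕ.≤? size G M
    ... | yes M′≤M = M′≤M
    ... | no  M′≰M =
      let M″ , isM″ , larger , keeps = augmenting matching isM′ (ℕ.≰⇒> M′≰M)
          adm″ = record { matching = isM″ ; nonneg = nonneg ; covering = covering ; vanishing = λ v exp → vanishing v (keeps v exp) }
      in ⊥-elim (minimal-≮ min adm″ (excess-antimonoˡ-< y larger))

  module _ {M y c} (opt : Optimal G M y c) where

    private
      min = optimal⇒minimal opt
      open Feasible⇒ (proj₁ opt)

    off-matching-zero : ∀ e → M e ≡ false → c e ≡ 0ℚ
    off-matching-zero e Me = trans (sym (concentrated e)) (cong (λ b → ind b (c e)) Me)
      where
      Σc≤Σ-on-M : Σℚ (m G) c ≤ Σℚ (m G) (λ e → ind (M e) (c e))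
      Σc≤Σ-on-M = ≤-trans (proj₂ opt M y (slack M y) (admissible⇒feasible admissible))
                          (≤-reflexive (trans (Σ-slack admissible) (sym Σ-on-M)))
      concentrated : ∀ e → ind (M e) (c e) ≡ c e
      concentrated = Σℚ-≤-tight (λ e → ind-≤ (M e) (proj₁ (proj₁ opt) e)) Σc≤Σ-on-M

    on-matching-≤1 : ∀ e → M e ≡ true → 0ℚ ≤ c e × c e ≤ 1ℚ
    on-matching-≤1 e Me =
      proj₁ (proj₁ opt) e ,
      subst (_≤ 1ℚ) (sym (tight e Me)) (+-monoˡ-≤ (- 1ℚ) (+-mono-≤ (minimal-≤1 min _) (minimal-≤1 min _)))

  unsettled? : (y : Vtx G → ℚ) → ∀ v → Dec (¬ ZeroHalfOne (y v))
  unsettled? y v = ¬? (zeroHalfOne? (y v))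

  unsettled : (Vtx G → ℚ) → Vtx G → Bool
  unsettled y v = does (unsettled? y v)

  Improved : EdgeSet G → (Vtx G → ℚ) → Set
  Improved M y = ∃ λ y′ → Admissible M y′ × (∀ v → y′ v ≤ 1ℚ) × Σℚ (n G) y′ ≤ Σℚ (n G) y ×
                          count (n G) (unsettled y′) ℕ.< count (n G) (unsettled y)

  Rounded : EdgeSet G → (Vtx G → ℚ) → Set
  Rounded M y = ∃ λ y′ → Admissible M y′ × (∀ v → ZeroHalfOne (y′ v)) × Σℚ (n G) y′ ≤ Σℚ (n G) y

  module Perturbation {M y} (adm : Admissible M y) (y≤1 : ∀ v → y v ≤ 1ℚ)
                      {b : Vtx G} (b-unsettled : ¬ ZeroHalfOne (y b)) where

    open Admissible adm

    pos : ∀ v → Position (y v)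
    pos v = position (nonneg v) (y≤1 v)

    module Along (d : Direction) where

      pivot : Vtx G
      pivot = argmin (λ v → room d (pos v)) b (filter (unsettled? y) (allFin (n G)))

      ε : ℚ
      ε = room d (pos pivot)

      y′ : Vtx G → ℚ
      y′ v = move d (pos v) ε

      ε-≤ : ∀ v → ¬ ZeroHalfOne (y v) → ε ≤ room d (pos v)
      ε-≤ v unset = lookup (f[argmin]≤f[xs] b _) (∈-filter⁺ (unsettled? y) (∈-allFin v) unset)

      y′-stays : ∀ v → Stays (pos v) (y′ v)
      y′-stays v = stays-or-settled (zeroHalfOne? (y v))
        where
        stays-or-settled : Dec (ZeroHalfOne (y v)) → Stays (pos v) (y′ v)
        stays-or-settled (yes set)   = stays-settled d (pos v) set
        stays-or-settled (no  unset) = stays d (pos v) (room-nonneg d (pos pivot)) (ε-≤ v unset)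

      admissible′ : Admissible M y′
      admissible′ = record
        { matching  = matching
        ; nonneg    = λ v → stays-nonneg (y′-stays v) (nonneg v)
        ; covering  = λ e → covers-after d (pos (end₁ e)) (pos (end₂ e)) (y′-stays (end₁ e)) (y′-stays (end₂ e)) (covering e)
        ; vanishing = λ v exp → trans (move-settled d (pos v) (inj₁ (vanishing v exp))) (vanishing v exp)
        }

      y′-≤1 : ∀ v → y′ v ≤ 1ℚ
      y′-≤1 v = stays-≤1 (y′-stays v) (y≤1 v)

      fewer-unsettled : count (n G) (unsettled y′) ℕ.< count (n G) (unsettled y)
      fewer-unsettled =
        count-mono-< (n G) (λ v → still-unsettled v (zeroHalfOne? (y v)) (zeroHalfOne? (y′ v))) pivot
          (dec-false (unsettled? y′ pivot) (λ unset → unset (move-room d (pos pivot))))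
          (dec-true (unsettled? y pivot) (argmin-all (λ v → room d (pos v)) b-unsettled (all-filter (unsettled? y) (allFin (n G)))))
        where
        still-unsettled : ∀ v (set? : Dec (ZeroHalfOne (y v))) (set′? : Dec (ZeroHalfOne (y′ v))) →
                          does (¬? set′?) ≡ true → does (¬? set?) ≡ true
        still-unsettled v (no  _)   _           _  = refl
        still-unsettled v (yes _)   (yes _)     ()
        still-unsettled v (yes set) (no  unset) _  = ⊥-elim (unset (subst ZeroHalfOne (sym (move-settled d (pos v) set)) set))

      Σy′ : Σℚ (n G) y′ ≡ Σℚ (n G) y + ε * Σℚ (n G) (λ v → slope d (pos v))
      Σy′ = trans (Σℚ-cong (λ v → move-slope d (pos v) ε))
          (trans (Σℚ-+ {n G} y _) (cong (Σℚ (n G) y +_) (Σℚ-*ˡ {n G} ε (λ v → slope d (pos v)))))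

    along : ∀ d → Σℚ (n G) (λ v → slope d (pos v)) ≤ 0ℚ → Improved M y
    along d Σslope≤0 =
      y′ , admissible′ , y′-≤1
          , subst (_≤ Σℚ (n G) y) (sym Σy′) (p+q*r≤p (room-nonneg d (pos pivot)) Σslope≤0) , fewer-unsettled
      where open Along d

    improvement : Improved M y
    improvement with Σℚ (n G) (λ v → slope outward (pos v)) ≤? 0ℚ
    ... | yes Σ≤0 = along outward Σ≤0
    ... | no  Σ≰0 = along inward (subst (_≤ 0ℚ) (sym Σinward) (neg-antimono-≤ (<⇒≤ (≰⇒> Σ≰0))))
      where
      Σinward : Σℚ (n G) (λ v → slope inward (pos v)) ≡ - Σℚ (n G) (λ v → slope outward (pos v))
      Σinward = trans (Σℚ-cong (λ v → slope-inward (pos v))) (Σℚ-neg {n G} (λ v → slope outward (pos v)))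

  round-to-halves : ∀ {M y} → Admissible M y → (∀ v → y v ≤ 1ℚ) → Rounded M y
  round-to-halves {M} adm y≤1 = go adm y≤1 (<-wellFounded _)
    where
    go : ∀ {y} → Admissible M y → (∀ v → y v ≤ 1ℚ) → Acc ℕ._<_ (count (n G) (unsettled y)) → Rounded M y
    go {y} adm y≤1 (acc smaller) = by-cases (any? (unsettled? y))
      where
      by-cases : Dec (∃ λ v → ¬ ZeroHalfOne (y v)) → Rounded M y
      by-cases (no none) = y , adm , (λ v → decidable-stable (zeroHalfOne? (y v)) (λ unset → none (v , unset))) , ≤-refl
      by-cases (yes (_ , unset)) =
        let y′ , adm′ , y′≤1 , Σy′≤Σy , fewer = Perturbation.improvement adm y≤1 unset
            y″ , adm″ , halves , Σy″≤Σy′ = go adm′ y′≤1 (smaller fewer)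
        in y″ , adm″ , halves , ≤-trans Σy″≤Σy′ Σy′≤Σy

  halve : ∀ {M y} → Admissible M y → Rounded M y
  halve {y = y} adm =
    let y′ , adm′ , halves , Σy′≤Σcap = round-to-halves (cap-admissible adm) (λ v → p⊓q≤q (y v) 1ℚ)
    in y′ , adm′ , halves , ≤-trans Σy′≤Σcap (Σℚ-mono-≤ (λ v → p⊓q≤p (y v) 1ℚ))

  vectors : ∀ {A : Set} k → List A → List (Fin k → A)
  vectors ℕ.zero    xs = (λ ()) ∷ []
  vectors (ℕ.suc k) xs = cartesianProductWith _∷ᶠ_ xs (vectors k xs)

  ∈-vectors : ∀ {A : Set} {k} {xs : List A} (f : Fin k → A) → (∀ i → f i ∈ xs) →
              ∃ λ g → g ∈ vectors k xs × (∀ i → g i ≡ f i)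
  ∈-vectors {k = ℕ.zero}  f _  = (λ ()) , here refl , λ ()
  ∈-vectors {k = ℕ.suc k} f f∈ =
    let g , g∈ , g≗ = ∈-vectors (f ∘ suc) (f∈ ∘ suc)
    in f zero ∷ᶠ g , ∈-cartesianProductWith⁺ _∷ᶠ_ (f∈ zero) g∈ , λ { zero → refl ; (suc i) → g≗ i }

  edge-sets : List (EdgeSet G)
  edge-sets = vectors (m G) (true ∷ false ∷ [])

  ∈-edge-sets : ∀ M → ∃ λ M′ → M′ ∈ edge-sets × (∀ e → M′ e ≡ M e)
  ∈-edge-sets M = ∈-vectors M (λ e → ∈-booleans (M e))
    where
    ∈-booleans : ∀ b → b ∈ true ∷ false ∷ []
    ∈-booleans true  = here refl
    ∈-booleans false = there (here refl)

  half-valuations : List (Vtx G → ℚ)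
  half-valuations = vectors (n G) (0ℚ ∷ ½ ∷ 1ℚ ∷ [])

  ∈-half-valuations : ∀ y → (∀ v → ZeroHalfOne (y v)) → ∃ λ y′ → y′ ∈ half-valuations × (∀ v → y′ v ≡ y v)
  ∈-half-valuations y halves = ∈-vectors y (λ v → ∈-halves (halves v))
    where
    ∈-halves : ∀ {p} → ZeroHalfOne p → p ∈ 0ℚ ∷ ½ ∷ 1ℚ ∷ []
    ∈-halves (inj₁ p≡0)        = here p≡0
    ∈-halves (inj₂ (inj₁ p≡½)) = there (here p≡½)
    ∈-halves (inj₂ (inj₂ p≡1)) = there (there (here p≡1))

  module _ {M M′ : EdgeSet G} (M≗M′ : ∀ e → M e ≡ M′ e) where

    IsMatching-resp : IsMatching G M → IsMatching G M′
    IsMatching-resp isM e f M′e M′f = isM e f (trans (M≗M′ e) M′e) (trans (M≗M′ f) M′f)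

    Admissible-resp : ∀ {y y′} → (∀ v → y v ≡ y′ v) → Admissible M y → Admissible M′ y′
    Admissible-resp {y} {y′} y≗y′ adm = record
      { matching  = IsMatching-resp matching
      ; nonneg    = λ v → subst (0ℚ ≤_) (y≗y′ v) (nonneg v)
      ; covering  = λ e → subst (1ℚ ≤_) (cong₂ _+_ (y≗y′ (end₁ e)) (y≗y′ (end₂ e))) (covering e)
      ; vanishing = λ v exp → trans (sym (y≗y′ v)) (vanishing v (λ e Me → exp e (trans (sym (M≗M′ e)) Me)))
      }
      where open Admissible adm

    excess-resp : ∀ {y y′} → (∀ v → y v ≡ y′ v) → excess M y ≡ excess M′ y′
    excess-resp y≗y′ = cong₂ (λ s k → s + - fromℕ k) (Σℚ-cong y≗y′) (count-cong (m G) M≗M′)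

  isMatching? : ∀ M → Dec (IsMatching G M)
  isMatching? M =
    all? λ e → all? λ f → (M e ≟ᵇ true) →-dec (M f ≟ᵇ true) →-dec ¬? (e ≟ᶠ f) →-dec
    all? λ v → inc? v e →-dec ¬? (inc? v f)

  admissible? : ∀ M y → Dec (Admissible M y)
  admissible? M y =
    map′ (λ (isM , y≥0 , covers , vanishes) → record { matching = isM ; nonneg = y≥0 ; covering = covers ; vanishing = vanishes })
         (λ adm → let open Admissible adm in matching , nonneg , covering , vanishing)
         (isMatching? M ×-dec all? (λ v → 0ℚ ≤? y v) ×-dec all? (λ e → 1ℚ ≤? y (end₁ e) + y (end₂ e)) ×-dec
          all? (λ v → exposed? v →-dec (y v ≟ 0ℚ)))
    where
    exposed? : ∀ v → Dec (Exposed G v M)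
    exposed? v = all? λ e → (M e ≟ᵇ true) →-dec ¬? (inc? v e)

  maximum-matching : ∃ λ M → IsMaxCardMatching G M
  maximum-matching = M , argmax-all (size G) (λ _ _ ()) (all-filter isMatching? edge-sets) , maximum
    where
    M = argmax (size G) (λ _ → false) (filter isMatching? edge-sets)
    maximum : ∀ M′ → IsMatching G M′ → size G M′ ℕ.≤ size G M
    maximum M′ isM′ =
      let M″ , M″∈ , M″≗M′ = ∈-edge-sets M′
      in subst (ℕ._≤ size G M) (count-cong (m G) M″≗M′)
           (lookup (f[xs]≤f[argmax] {f = size G} (λ _ → false) _) (∈-filter⁺ isMatching? M″∈ (IsMatching-resp (sym ∘ M″≗M′) isM′)))

  cover-of : EdgeSet G → Vtx G → ℚ
  cover-of M v = ind (covers M v) 1ℚ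

  maximum⇒admissible : ∀ {M} → IsMaxCardMatching G M → Admissible M (cover-of M)
  maximum⇒admissible {M} (isM , maximum) = record
    { matching  = isM
    ; nonneg    = λ v → ind-nonneg (covers M v) (<⇒≤ 0<1)
    ; covering  = λ e → cover-edge e (covered? M (end₁ e)) (covered? M (end₂ e))
    ; vanishing = λ v exp → cong (λ b → ind b 1ℚ) (dec-false (covered? M v) (Exposed⇒¬Covered exp))
    }
    where
    cover-edge : ∀ e (c₁ : Dec (Covered M (end₁ e))) (c₂ : Dec (Covered M (end₂ e)))
        → 1ℚ ≤ ind (does c₁) 1ℚ + ind (does c₂) 1ℚ
    cover-edge e (yes _)  c₂      = 1≤1+p (ind-nonneg (does c₂) (<⇒≤ 0<1))
    cover-edge e (no _)   (yes _) = ≤-refl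
    cover-edge e (no ¬c₁) (no ¬c₂) = ⊥-elim (ℕ.<-irrefl refl
        (ℕ.≤-trans (ℕ.≤-reflexive (sym (count-insert (m G) M e Me))) (maximum _ (insert-matching e isM exp₁ exp₂))))
      where
      exp₁ = ¬Covered⇒Exposed ¬c₁
      exp₂ = ¬Covered⇒Exposed ¬c₂
      Me : M e ≡ false
      Me with M e in eq
      ... | false = refl
      ... | true  = ⊥-elim (exp₁ e eq (inc₁ e))

  HalfAdmissible : EdgeSet G × (Vtx G → ℚ) → Set
  HalfAdmissible (M , y) = Admissible M y × (∀ v → ZeroHalfOne (y v))

  minimal-half-valued : ∃ λ M → ∃ λ y → Minimal M y × (∀ v → ZeroHalfOne (y v))
  minimal-half-valued =
    let adm* , halves* = best-half-admissible in proj₁ best , proj₂ best , (adm* , minimal) , halves*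
    where
    halfAdmissible? : ∀ c → Dec (HalfAdmissible c)
    halfAdmissible? (M , y) = admissible? M y ×-dec all? (λ v → zeroHalfOne? (y v))

    excessᶜ : EdgeSet G × (Vtx G → ℚ) → ℚ
    excessᶜ (M , y) = excess M y

    M₀ = proj₁ maximum-matching

    start : HalfAdmissible (M₀ , cover-of M₀)
    start = maximum⇒admissible (proj₂ maximum-matching) , λ v → indicator-half (covers M₀ v)
      where
      indicator-half : ∀ b → ZeroHalfOne (ind b 1ℚ)
      indicator-half true  = inj₂ (inj₂ refl)
      indicator-half false = inj₁ refl

    candidates : List (EdgeSet G × (Vtx G → ℚ))
    candidates = filter halfAdmissible? (cartesianProduct edge-sets half-valuations)

    best : EdgeSet G × (Vtx G → ℚ)
    best = argmin excessᶜ (M₀ , cover-of M₀) candidates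

    best-half-admissible : HalfAdmissible best
    best-half-admissible = argmin-all excessᶜ start (all-filter halfAdmissible? (cartesianProduct edge-sets half-valuations))

    minimal : ∀ M′ y′ → Admissible M′ y′ → excessᶜ best ≤ excess M′ y′
    minimal M′ y′ adm′ =
      let y″ , adm″ , halves″ , Σy″≤Σy′ = halve adm′
          M‴ , M‴∈ , M‴≗M′ = ∈-edge-sets M′
          y‴ , y‴∈ , y‴≗y″ = ∈-half-valuations y″ halves″
          candidate = ∈-filter⁺ halfAdmissible? (∈-cartesianProduct⁺ M‴∈ y‴∈)
                        (Admissible-resp (sym ∘ M‴≗M′) (sym ∘ y‴≗y″) adm″ , λ v → subst ZeroHalfOne (sym (y‴≗y″ v)) (halves″ v))
      in begin
        excessᶜ best     ≤⟨ lookup (f[argmin]≤f[xs] {f = excessᶜ} (M₀ , cover-of M₀) candidates) candidate ⟩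
        excess M‴ y‴     ≡⟨ excess-resp M‴≗M′ y‴≗y″ ⟩
        excess M′ y″     ≤⟨ +-monoˡ-≤ (- fromℕ (size G M′)) Σy″≤Σy′ ⟩
        excess M′ y′     ∎
      where open ≤-Reasoning

  zeros : (Vtx G → ℚ) → Vtx G → Bool
  zeros y x = does (y x ≟ 0ℚ)

  FewerZeros : EdgeSet G → (Vtx G → ℚ) → Set
  FewerZeros M y = ∃ λ y′ → Minimal M y′ × (∀ x → ZeroHalfOne (y′ x))
      × count (n G) (zeros y′) ℕ.< count (n G) (zeros y)

  -- S grows from the M-edge at v as a union of M-edges of weight 1 whose vertices of value 1 can be exposed
  -- together with v by a matching one edge smaller than M. An edge from s ∈ S to z ∉ S with y z = 0 either
  -- ends at an M-exposed z, giving a maximum matching that exposes v, or S absorbs the M-edge at z. If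
  -- there is no such edge, y may be raised to ½ on S: it still covers, and Σ y is unchanged.
  module Closure {M y} (min : Minimal M y) (halves : ∀ x → ZeroHalfOne (y x)) {v} (yv≡0 : y v ≡ 0ℚ) where

    open Admissible (proj₁ min)

    ends-sum : ∀ {a e} (a∈e : Inc G a e) → y (end₁ e) + y (end₂ e) ≡ y a + y (opposite a∈e)
    ends-sum (inj₁ refl) = refl
    ends-sum {e = e} (inj₂ refl) = +-comm (y (end₁ e)) (y (end₂ e))

    one-beside-zero : ∀ {a b e} (a∈e : Inc G a e) → Inc G b e → b ≢ a → y a ≡ 0ℚ → y b ≡ 1ℚ
    one-beside-zero {a} {b} a∈e b∈e b≢a ya≡0 with Inc-ends a∈e b∈e
    ... | inj₁ b≡a = ⊥-elim (b≢a b≡a)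
    ... | inj₂ refl = ZeroHalfOne-≥1 (halves b)
      (subst (1ℚ ≤_) (trans (ends-sum a∈e) (trans (cong (_+ y b) ya≡0) (+-identityˡ (y b)))) (covering _))

    record Witness (S : VSet) (s : Vtx G) : Set where
      field
        N         : EdgeSet G
        matching  : IsMatching G N
        one-less  : suc (size G N) ≡ size G M
        v-exposed : Exposed G v N
        s-exposed : Exposed G s N
        within    : ∀ x → Exposed G x M → Exposed G x N
        outside   : ∀ e → M e ≡ true → S (end₁ e) ≡ false → N e ≡ true

    record Closed (S : VSet) : Set where
      field
        closed  : ∀ e → M e ≡ true → S (end₁ e) ≡ S (end₂ e)
        covered : ∀ x → S x ≡ true → Covered M x
        tight   : ∀ e → M e ≡ true → S (end₁ e) ≡ true → y (end₁ e) + y (end₂ e) ≡ 1ℚ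

    record Structure (S : VSet) : Set where
      field
        v∈S       : S v ≡ true
        isClosed  : Closed S
        witnesses : ∀ s → S s ≡ true → y s ≡ 1ℚ → Witness S s
      open Closed isClosed public

    same-side : ∀ {S e x x′} → Closed S → M e ≡ true → Inc G x e → Inc G x′ e → S x ≡ S x′
    same-side _       _  (inj₁ refl) (inj₁ refl) = refl
    same-side S-closed Me (inj₁ refl) (inj₂ refl) = Closed.closed S-closed _ Me
    same-side S-closed Me (inj₂ refl) (inj₁ refl) = sym (Closed.closed S-closed _ Me)
    same-side _       _  (inj₂ refl) (inj₂ refl) = refl

    Closed-∅ : Closed (λ _ → false)
    Closed-∅ = record { closed = λ _ _ → refl ; covered = λ _ () ; tight = λ _ _ () }

    module Extend {S} (S-closed : Closed S) {g} (Mg : M g ≡ true) (tight-g : y (end₁ g) + y (end₂ g) ≡ 1ℚ) where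

      open Closed S-closed

      S⁺ : VSet
      S⁺ = insert (end₁ g) (insert (end₂ g) S)

      S⊆S⁺ : ∀ {x} → S x ≡ true → S⁺ x ≡ true
      S⊆S⁺ x∈S = insert⁺ (end₁ g) _ (insert⁺ (end₂ g) S x∈S)

      ends∈S⁺ : ∀ {x} → Inc G x g → S⁺ x ≡ true
      ends∈S⁺ (inj₁ refl) = insert-≡ (end₁ g) _
      ends∈S⁺ (inj₂ refl) = insert⁺ (end₁ g) _ (insert-≡ (end₂ g) S)

      S⁺-cases : ∀ {x} → S⁺ x ≡ true → Inc G x g ⊎ S x ≡ true
      S⁺-cases x∈S⁺ with insert⁻ (end₁ g) _ x∈S⁺
      ... | inj₁ refl = inj₁ (inc₁ g)
      ... | inj₂ x∈S′ with insert⁻ (end₂ g) S x∈S′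
      ...   | inj₁ refl = inj₁ (inc₂ g)
      ...   | inj₂ x∈S  = inj₂ x∈S

      S⁺-other : ∀ {x} → ¬ Inc G x g → S⁺ x ≡ S x
      S⁺-other x∉g = trans (insert-≢ _ (λ x≡ → x∉g (inj₁ (sym x≡)))) (insert-≢ S (λ x≡ → x∉g (inj₂ (sym x≡))))

      S⁺-away : ∀ {e x} → M e ≡ true → e ≢ g → Inc G x e → S⁺ x ≡ S x
      S⁺-away Me e≢g x∈e = S⁺-other (matched-disjoint matching Me Mg e≢g x∈e)

      Closed-S⁺ : Closed S⁺
      Closed-S⁺ = record { closed = closed⁺ ; covered = covered⁺ ; tight = tight⁺ }
        where
        closed⁺ : ∀ e → M e ≡ true → S⁺ (end₁ e) ≡ S⁺ (end₂ e)
        closed⁺ e Me with e ≟ᶠ g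
        ... | yes refl = trans (ends∈S⁺ (inc₁ g)) (sym (ends∈S⁺ (inc₂ g)))
        ... | no  e≢g  = trans (S⁺-away Me e≢g (inc₁ e)) (trans (closed e Me) (sym (S⁺-away Me e≢g (inc₂ e))))
        covered⁺ : ∀ x → S⁺ x ≡ true → Covered M x
        covered⁺ x x∈S⁺ with S⁺-cases x∈S⁺
        ... | inj₁ x∈g = g , Mg , x∈g
        ... | inj₂ x∈S = covered x x∈S
        tight⁺ : ∀ e → M e ≡ true → S⁺ (end₁ e) ≡ true → y (end₁ e) + y (end₂ e) ≡ 1ℚ
        tight⁺ e Me e₁∈S⁺ with e ≟ᶠ g
        ... | yes refl = tight-g
        ... | no  e≢g  = tight e Me (trans (sym (S⁺-away Me e≢g (inc₁ e))) e₁∈S⁺)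

      Witness-S⁺ : ∀ {s} → Witness S s → Witness S⁺ s
      Witness-S⁺ w = record
        { N = W.N ; matching = W.matching ; one-less = W.one-less ; v-exposed = W.v-exposed ; s-exposed = W.s-exposed
        ; within = W.within
        ; outside = λ e Me e₁∉S⁺ → W.outside e Me (¬-not (λ e₁∈S → not-¬ (S⊆S⁺ e₁∈S) e₁∉S⁺))
        }
        where module W = Witness w

    module Start {ev} (Mev : M ev ≡ true) (v∈ev : Inc G v ev) where

      open Extend Closed-∅ Mev
        (trans (ends-sum v∈ev) (cong₂ _+_ yv≡0 (one-beside-zero v∈ev (Inc-opposite v∈ev) (opposite≢ v∈ev) yv≡0)))

      structure : Structure S⁺
      structure = record { v∈S = ends∈S⁺ v∈ev ; isClosed = Closed-S⁺ ; witnesses = witness }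
        where
        witness : ∀ s → S⁺ s ≡ true → y s ≡ 1ℚ → Witness S⁺ s
        witness s s∈S⁺ _ with S⁺-cases s∈S⁺
        ... | inj₂ ()
        ... | inj₁ s∈ev = record
          { N         = delete ev M
          ; matching  = delete-matching ev matching
          ; one-less  = count-delete (m G) M ev Mev
          ; v-exposed = delete-exposes matching Mev v∈ev
          ; s-exposed = delete-exposes matching Mev s∈ev
          ; within    = λ _ → delete-exposed
          ; outside   = λ e Me e₁∉S⁺ → trans (delete-≢ M (λ { refl → not-¬ (ends∈S⁺ (inc₁ ev)) e₁∉S⁺ })) Me
          }

    ExitAt : VSet → Edge G → Set
    ExitAt S f = (S (end₁ f) ≡ true × S (end₂ f) ≡ false × y (end₂ f) ≡ 0ℚ)
               ⊎ (S (end₂ f) ≡ true × S (end₁ f) ≡ false × y (end₁ f) ≡ 0ℚ)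

    exitAt? : ∀ S f → Dec (ExitAt S f)
    exitAt? S f = (S (end₁ f) ≟ᵇ true ×-dec S (end₂ f) ≟ᵇ false ×-dec y (end₂ f) ≟ 0ℚ)
             ⊎-dec (S (end₂ f) ≟ᵇ true ×-dec S (end₁ f) ≟ᵇ false ×-dec y (end₁ f) ≟ 0ℚ)

    record Exit (S : VSet) : Set where
      field
        f    : Edge G
        s    : Vtx G
        s∈f  : Inc G s f
        s∈S  : S s ≡ true
        z∉S  : S (opposite s∈f) ≡ false
        yz≡0 : y (opposite s∈f) ≡ 0ℚ

    exit : ∀ {S f} → ExitAt S f → Exit S
    exit {f = f} (inj₁ (s∈S , z∉S , yz≡0)) = record { f = f ; s∈f = inc₁ f ; s∈S = s∈S ; z∉S = z∉S ; yz≡0 = yz≡0 }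
    exit {f = f} (inj₂ (s∈S , z∉S , yz≡0)) = record { f = f ; s∈f = inc₂ f ; s∈S = s∈S ; z∉S = z∉S ; yz≡0 = yz≡0 }

    module AtExit {S} (str : Structure S) (ex : Exit S) where

      open Structure str
      open Exit ex

      z : Vtx G
      z = opposite s∈f

      z∈f : Inc G z f
      z∈f = Inc-opposite s∈f

      S-differs : ∀ {a b} → S a ≡ true → S b ≡ false → a ≢ b
      S-differs a∈S b∉S refl = not-¬ a∈S b∉S

      ys≡1 : y s ≡ 1ℚ
      ys≡1 = one-beside-zero z∈f s∈f (S-differs s∈S z∉S) yz≡0

      v∉f : ¬ Inc G v f
      v∉f v∈f with Inc-ends s∈f v∈f
      ... | inj₁ refl = 1≢0 (trans (sym ys≡1) yv≡0)
      ... | inj₂ v≡z  = S-differs v∈S z∉S v≡z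

      module W = Witness (witnesses s s∈S ys≡1)

      f∉N : W.N f ≡ false
      f∉N = ¬-not (λ Nf → W.s-exposed f Nf s∈f)

      exposed-exit : Exposed G z M → InX G v
      exposed-exit z-exposed =
        insert f W.N ,
        (insert-matching f W.matching (f-ends-exposed (inc₁ f)) (f-ends-exposed (inc₂ f)) ,
         λ M′ isM′ → subst (size G M′ ℕ.≤_) (sym size′) (proj₂ (minimal-maximum min) M′ isM′)) ,
        insert-exposed W.v-exposed v∉f
        where
        f-ends-exposed : ∀ {x} → Inc G x f → Exposed G x W.N
        f-ends-exposed x∈f with Inc-ends s∈f x∈f
        ... | inj₁ refl = W.s-exposed
        ... | inj₂ refl = W.within z z-exposed
        size′ : size G (insert f W.N) ≡ size G M
        size′ = trans (count-insert (m G) W.N f f∉N) W.one-less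

      module Grow {g} (Mg : M g ≡ true) (z∈g : Inc G z g) where

        z′ : Vtx G
        z′ = opposite z∈g

        z′∈g : Inc G z′ g
        z′∈g = Inc-opposite z∈g

        yz′≡1 : y z′ ≡ 1ℚ
        yz′≡1 = one-beside-zero z∈g z′∈g (opposite≢ z∈g) yz≡0

        open Extend isClosed Mg (trans (ends-sum z∈g) (cong₂ _+_ yz≡0 yz′≡1)) public

        g-ends-∉S : ∀ {x} → Inc G x g → S x ≡ false
        g-ends-∉S x∈g = trans (same-side isClosed Mg x∈g z∈g) z∉S

        f≢g : f ≢ g
        f≢g refl = not-¬ s∈S (g-ends-∉S s∈f)

        Ng : W.N g ≡ true
        Ng = W.outside g Mg (g-ends-∉S (inc₁ g))

        N′ : EdgeSet G
        N′ = insert f (delete g W.N)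

        f-ends-exposed : ∀ {x} → Inc G x f → Exposed G x (delete g W.N)
        f-ends-exposed x∈f with Inc-ends s∈f x∈f
        ... | inj₁ refl = delete-exposed W.s-exposed
        ... | inj₂ refl = delete-exposes W.matching Ng z∈g

        z′∉f : ¬ Inc G z′ f
        z′∉f z′∈f with Inc-ends s∈f z′∈f
        ... | inj₁ z′≡s = S-differs s∈S (g-ends-∉S z′∈g) (sym z′≡s)
        ... | inj₂ z′≡z = opposite≢ z∈g z′≡z

        witness′ : Witness S⁺ z′
        witness′ = record
          { N         = N′
          ; matching  = insert-matching f (delete-matching g W.matching) (f-ends-exposed (inc₁ f)) (f-ends-exposed (inc₂ f))
          ; one-less  = trans (cong suc (count-insert (m G) _ f (trans (delete-≢ W.N f≢g) f∉N)))
                              (trans (cong suc (count-delete (m G) W.N g Ng)) W.one-less)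
          ; v-exposed = insert-exposed (delete-exposed W.v-exposed) v∉f
          ; s-exposed = insert-exposed (delete-exposes W.matching Ng z′∈g) z′∉f
          ; within    = λ x x-exposed → insert-exposed (delete-exposed (W.within x x-exposed)) (outside-f x-exposed)
          ; outside   = outside′
          }
          where
          outside-f : ∀ {x} → Exposed G x M → ¬ Inc G x f
          outside-f x-exposed x∈f with Inc-ends s∈f x∈f
          ... | inj₁ refl = Exposed⇒¬Covered x-exposed (covered s s∈S)
          ... | inj₂ refl = x-exposed g Mg z∈g
          outside′ : ∀ e → M e ≡ true → S⁺ (end₁ e) ≡ false → N′ e ≡ true
          outside′ e Me e₁∉S⁺ =
            insert⁺ f _ (trans (delete-≢ W.N e≢g) (W.outside e Me (¬-not (λ e₁∈S → not-¬ (S⊆S⁺ e₁∈S) e₁∉S⁺))))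
            where
            e≢g : e ≢ g
            e≢g refl = not-¬ (ends∈S⁺ (inc₁ g)) e₁∉S⁺

        structure′ : Structure S⁺
        structure′ = record { v∈S = S⊆S⁺ v∈S ; isClosed = Closed-S⁺ ; witnesses = witnesses′ }
          where
          witnesses′ : ∀ s′ → S⁺ s′ ≡ true → y s′ ≡ 1ℚ → Witness S⁺ s′
          witnesses′ s′ s′∈S⁺ ys′≡1 with S⁺-cases s′∈S⁺
          ... | inj₂ s′∈S = Witness-S⁺ (witnesses s′ s′∈S ys′≡1)
          ... | inj₁ s′∈g with Inc-ends z∈g s′∈g
          ...   | inj₁ refl = ⊥-elim (1≢0 (trans (sym ys′≡1) yz≡0))
          ...   | inj₂ refl = witness′

        grows : count (n G) S ℕ.< count (n G) S⁺
        grows = count-mono-< (n G) (λ _ → S⊆S⁺) z z∉S (ends∈S⁺ z∈g)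

    spread : Bool → ℚ → ℚ
    spread true  _ = ½
    spread false p = p

    module Spread {S} (str : Structure S) (no-exit : ∀ f → ¬ ExitAt S f) where

      open Structure str

      y′ : Vtx G → ℚ
      y′ x = spread (S x) (y x)

      outside-S : ∀ {x} → S x ≡ false → y′ x ≡ y x
      outside-S x∉S rewrite x∉S = refl

      exposed-outside : ∀ {x} → Exposed G x M → S x ≡ false
      exposed-outside x-exposed = ¬-not (λ x∈S → Exposed⇒¬Covered x-exposed (covered _ x∈S))

      covering′ : ∀ e → 1ℚ ≤ y′ (end₁ e) + y′ (end₂ e)
      covering′ e with S (end₁ e) in e₁∈? | S (end₂ e) in e₂∈?
      ... | true  | true  = ≤-refl
      ... | true  | false = +-monoʳ-≤ ½
          (ZeroHalfOne-≢0 (halves _) (λ y₂≡0 → no-exit e (inj₁ (e₁∈? , e₂∈? , y₂≡0))))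
      ... | false | true  = subst (1ℚ ≤_) (+-comm ½ (y (end₁ e)))
          (+-monoʳ-≤ ½ (ZeroHalfOne-≢0 (halves _) (λ y₁≡0 → no-exit e (inj₂ (e₂∈? , e₁∈? , y₁≡0)))))
      ... | false | false = covering e

      admissible′ : Admissible M y′
      admissible′ = record
        { matching  = matching
        ; nonneg    = λ x → nonneg′ (S x) (nonneg x)
        ; covering  = covering′
        ; vanishing = λ x x-exposed → trans (outside-S (exposed-outside x-exposed)) (vanishing x x-exposed)
        }
        where
        nonneg′ : ∀ b {p} → 0ℚ ≤ p → 0ℚ ≤ spread b p
        nonneg′ true  _   = <⇒≤ 0<½
        nonneg′ false 0≤p = 0≤p

      Σy′≡Σy : Σℚ (n G) y′ ≡ Σℚ (n G) y
      Σy′≡Σy = solve-for (trans (sym (Σℚ-- {n G} y′ y)) Σd≡0)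
        where
        d : Vtx G → ℚ
        d x = y′ x - y x
        d-outside : ∀ {x} → S x ≡ false → d x ≡ 0ℚ
        d-outside {x} x∉S = trans (cong (_- y x) (outside-S x∉S)) (+-inverseʳ (y x))
        d-edge : ∀ e → ind (M e) (d (end₁ e) + d (end₂ e)) ≡ 0ℚ
        d-edge e with M e in Me | S (end₁ e) in e₁∈? | S (end₂ e) in e₂∈?
        ... | false | _     | _     = refl
        ... | true  | true  | true  = trans (solve 2 (λ a b → con ½ :- a :+ (con ½ :- b) := con 1ℚ :- (a :+ b))
            refl (y (end₁ e)) (y (end₂ e)))
                                            (trans (cong (λ t → 1ℚ - t) (tight e Me e₁∈?)) (+-inverseʳ 1ℚ))
        ... | true  | false | false = cong₂ _+_ (+-inverseʳ (y (end₁ e))) (+-inverseʳ (y (end₂ e)))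
        ... | true  | true  | false = ⊥-elim (not-¬ e₁∈? (trans (closed e Me) e₂∈?))
        ... | true  | false | true  = ⊥-elim (not-¬ e₂∈? (trans (sym (closed e Me)) e₁∈?))
        Σd≡0 : Σℚ (n G) d ≡ 0ℚ
        Σd≡0 = trans (sym (Σ-endpoints matching d (λ x x-exposed → d-outside (exposed-outside x-exposed)))) (Σℚ-zero d-edge)
        solve-for : ∀ {a b} → a - b ≡ 0ℚ → a ≡ b
        solve-for {a} {b} a-b≡0 = trans (solve 2 (λ a b → a := a :- b :+ b) refl a b) (trans (cong (_+ b) a-b≡0) (+-identityˡ b))

      fewer : FewerZeros M y
      fewer =
        y′ , (admissible′ , λ M′ y″ adm″ → subst (_≤ excess M′ y″) (cong (_- fromℕ (size G M)) (sym Σy′≡Σy))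
            (proj₂ min M′ y″ adm″)) ,
        halves′ ,
        count-mono-< (n G) (λ x → zero-stays x (y′ x ≟ 0ℚ) (y x ≟ 0ℚ)) v
          (dec-false (y′ v ≟ 0ℚ) (λ y′v≡0 → ½≢0 (trans (cong (λ b → spread b (y v)) (sym v∈S)) y′v≡0)))
          (dec-true (y v ≟ 0ℚ) yv≡0)
        where
        ½≢0 : ½ ≢ 0ℚ
        ½≢0 ()
        halves′ : ∀ x → ZeroHalfOne (y′ x)
        halves′ x with S x
        ... | true  = inj₂ (inj₁ refl)
        ... | false = halves x
        zero-stays : ∀ x (z′? : Dec (y′ x ≡ 0ℚ)) (z? : Dec (y x ≡ 0ℚ)) → does z′? ≡ true → does z? ≡ true
        zero-stays x (no _)     _        ()
        zero-stays x (yes _)    (yes _)  _ = refl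
        zero-stays x (yes y′≡0) (no y≢0) _ with S x
        ... | true  = ⊥-elim (½≢0 y′≡0)
        ... | false = ⊥-elim (y≢0 y′≡0)

    grow : ∀ {S} → Structure S → Acc ℕ._<_ (n G ∸ count (n G) S) → InX G v ⊎ FewerZeros M y
    grow {S} str (acc larger) = at-exit (any? (exitAt? S))
      where
      at-exit : Dec (∃ (ExitAt S)) → InX G v ⊎ FewerZeros M y
      at-exit (no  none)       = inj₂ (Spread.fewer str (λ f at-f → none (f , at-f)))
      at-exit (yes (_ , at-f)) = beyond (covered? M z)
        where
        open AtExit str (exit at-f)
        beyond : Dec (Covered M z) → InX G v ⊎ FewerZeros M y
        beyond (no  ¬cov)           = inj₁ (exposed-exit (¬Covered⇒Exposed ¬cov))
        beyond (yes (g , Mg , z∈g)) = grow structure′ (larger (ℕ.∸-monoʳ-< grows (count-≤ (n G) S⁺)))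
          where open Grow Mg z∈g

    result : InX G v ⊎ FewerZeros M y
    result = from (covered? M v)
      where
      from : Dec (Covered M v) → InX G v ⊎ FewerZeros M y
      from (no  ¬cov)             = inj₁ (M , minimal-maximum min , ¬Covered⇒Exposed ¬cov)
      from (yes (ev , Mev , v∈ev)) = grow (Start.structure Mev v∈ev) (<-wellFounded _)

  all-or-some : ∀ {k} {P : Fin k → Set} {Q : Set} → (∀ i → P i ⊎ Q) → (∀ i → P i) ⊎ Q
  all-or-some {ℕ.zero}  _      = inj₁ (λ ())
  all-or-some {ℕ.suc k} P⊎Q with P⊎Q zero | all-or-some (P⊎Q ∘ suc)
  ... | inj₂ q  | _        = inj₂ q
  ... | inj₁ _  | inj₂ q   = inj₂ q
  ... | inj₁ p₀ | inj₁ ps  = inj₁ λ { zero → p₀ ; (suc i) → ps i }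

  ZerosInX : EdgeSet G → Set
  ZerosInX M = ∃ λ y → Minimal M y × (∀ x → ZeroHalfOne (y x)) × (∀ x → y x ≡ 0ℚ → InX G x)

  zeros-into-X : ∀ {M y} → Minimal M y → (∀ x → ZeroHalfOne (y x)) → ZerosInX M
  zeros-into-X min halves = go min halves (<-wellFounded _)
    where
    go : ∀ {M y} → Minimal M y → (∀ x → ZeroHalfOne (y x)) → Acc ℕ._<_ (count (n G) (zeros y)) → ZerosInX M
    go {y = y} min halves (acc fewer) = settle (all-or-some (λ x → at x (y x ≟ 0ℚ)))
      where
      at : ∀ x → Dec (y x ≡ 0ℚ) → (y x ≡ 0ℚ → InX G x) ⊎ FewerZeros _ y
      at x (no  yx≢0) = inj₁ (λ yx≡0 → ⊥-elim (yx≢0 yx≡0))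
      at x (yes yx≡0) = map₁ (λ x∈X _ → x∈X) (Closure.result min halves yx≡0)
      settle : (∀ x → y x ≡ 0ℚ → InX G x) ⊎ FewerZeros _ y → ZerosInX _
      settle (inj₁ all-in-X)                     = y , min , halves , all-in-X
      settle (inj₂ (y′ , min′ , halves′ , less)) = go min′ halves′ (fewer less)

theorem5 : (G : Graph) →
    ((M : EdgeSet G) (y : Vtx G → ℚ) (c : Edge G → ℚ) → Optimal G M y c →
      ((∀ e → M e ≡ false → c e ≡ 0ℚ) × (∀ e → M e ≡ true → 0ℚ ≤ c e × c e ≤ 1ℚ))
      × IsMaxCardMatching G M)
    × (∃ λ M → ∃ λ y → ∃ λ c → Optimal G M y c × HalfIntegral G c ×
        (∀ v → y v ≡ 0ℚ ⊎ y v ≡ ½ ⊎ y v ≡ 1ℚ) × (∀ v → InY G v → 0ℚ < y v))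
theorem5 G =
  (λ M y c opt → (off-matching-zero G opt , on-matching-≤1 G opt) , minimal-maximum G (optimal⇒minimal G opt)) ,
  (let M , y₀ , min₀ , halves₀ = minimal-half-valued G
       y , min , halves , zeros∈X = zeros-into-X G min₀ halves₀
   in M , y , slack G M y , minimal⇒optimal G min ,
      (λ e → ind-half-integral (M e) (halves _) (halves _)) , halves ,
      λ v (v∉X , _) → ZeroHalfOne-pos (halves v) (λ yv≡0 → v∉X (zeros∈X v yv≡0)))
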